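{- Let $D,E$ be as defined in the context and let $i,j,k,\ell\ge0$. For any staircase tableau $\mathcal{T}$ (of any size $n\ge0$) with exactly $i$ rows indexed by $\delta$ and $k$ rows indexed by $\alpha/\gamma$, $D_{i,j,k,\ell}$ equals the sum of $\mathrm{wt}(\mathcal{T}')/\mathrm{wt}(\mathcal{T})$ over all staircase tableaux $\mathcal{T}'$ obtained by adding a new column on the left of $\mathcal{T}$ whose bottom box is labeled $\alpha$ or $\delta$, such that $\mathcal{T}'$ has exactly $j$ rows indexed by $\delta$ and $\ell$ rows indexed by $\alpha/\gamma$. Similarly $E_{i,j,k,\ell}$ equals the same sum over new columns whose bottom box is labeled $\beta$ or $\gamma$.
   Context: Parameters $\alpha,\beta,\gamma,\delta,q$ (with $u=1$). For nonnegative integers $i,j,k,\ell$ define $D_{i,j,k,\ell}$ and $E_{i,j,k,\ell}$ recursively (any entry with a negative index is $0$): $D_{i,j,k,\ell}=0$ if $j<i$ or $\ell>k+1$; $=\delta q^i$ if $j=i+1$, $k=\ell=0$; $=\alpha q^i$ if $j=i$, $k=0$, $\ell=1$; otherwise $D_{i,j,k,\ell}=\delta(D_{i,j-1,k-1,\ell}+E_{i,j-1,k-1,\ell})+D_{i,j,k-1,\ell-1}$. $E_{i,j,k,\ell}=0$ if $j<i$ or $\ell>k+1$; $=\beta q^i$ if $j=i$, $k=\ell=0$; $=\gamma q^i$ if $j=i$, $k=0$, $\ell=1$; otherwise $E_{i,j,k,\ell}=\beta(D_{i,j,k-1,\ell}+E_{i,j,k-1,\ell})+qE_{i,j,k-1,\ell-1}$.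 Staircase tableau of size $n$: Young diagram of shape $(n,\dots,1)$ (English notation; diagonal boxes are last boxes of rows), boxes empty or labeled $\alpha,\beta,\gamma,\delta$, no diagonal box empty, all boxes left of a $\beta$ or $\delta$ in its row empty, all boxes above an $\alpha$ or $\gamma$ in its column empty. Weight (with $u=1$): each empty box gets factor $1$ if the closest label to its right is $\beta$, $q$ if it is $\delta$; if it is $\alpha$ or $\gamma$, factor $1$ if the closest label below it is $\alpha$ or $\delta$ and $q$ if it is $\beta$ or $\gamma$; $\mathrm{wt}$ is the product of all labels and factors. A row is indexed by $x$ if its leftmost labeled box has label $x$; "indexed by $\alpha/\gamma$" means by $\alpha$ or $\gamma$. Adding a new column on the left of a staircase tableau $\mathcal{T}$ of size $n$ means forming a staircase tableau $\mathcal{T}'$ of size $n+1$ whose boxes outside its leftmost column (of height $n+1$) form $\mathcal{T}$. -}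

module Defs where

open import Level using (Level)
open import Data.Bool using (Bool; true; false; _∧_; _∨_; not; if_then_else_)
open import Data.Maybe using (Maybe; just; nothing)
open import Data.Nat as ℕ using (ℕ; zero; suc; _∸_; _<ᵇ_; _≡ᵇ_)
open import Data.List.Base using (List; []; _∷_; map; upTo; foldr; concatMap)
open import Algebra.Bundles using (CommutativeSemiring)

data Lab : Set where
  α β γ δ : Lab

-- A (candidate) filling: cell (row r, column c), both 0-indexed from the
-- top-left corner (English notation).
-- For a tableau of size n only the cells with r + c < n (the staircase
-- shape (n, n-1, ..., 1)) are ever inspected; the diagonal boxes are those
-- with r + c = n - 1.
Tab : Set
Tab = ℕ → ℕ → Maybe Lab

range : ℕ → ℕ → List ℕ
range a b = map (a ℕ.+_) (upTo (b ∸ a))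

all : {A : Set} → (A → Bool) → List A → Bool
all p [] = true
all p (x ∷ xs) = p x ∧ all p xs

firstJust : {A : Set} → List (Maybe A) → Maybe A
firstJust [] = nothing
firstJust (just x ∷ _) = just x
firstJust (nothing ∷ xs) = firstJust xs

isEmpty : Maybe Lab → Bool
isEmpty nothing = true
isEmpty (just _) = false

isβδ : Maybe Lab → Bool
isβδ (just β) = true
isβδ (just δ) = true
isβδ _ = false

isαγ : Maybe Lab → Bool
isαγ (just α) = true
isαγ (just γ) = true
isαγ _ = false

isαδ : Maybe Lab → Bool
isαδ (just α) = true
isαδ (just δ) = true
isαδ _ = false

isβγ : Maybe Lab → Bool
isβγ (just β) = true
isβγ (just γ) = true
isβγ _ = false

isδ : Maybe Lab → Bool
isδ (just δ) = true
isδ _ = false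

rows : ℕ → List ℕ
rows n = upTo n

colsOf : ℕ → ℕ → List ℕ
colsOf n r = upTo (n ∸ r)

allBoxes : ℕ → (ℕ → ℕ → Bool) → Bool
allBoxes n p = all (λ r → all (λ c → p r c) (colsOf n r)) (rows n)

isStaircase : ℕ → Tab → Bool
isStaircase n T =
  all (λ r → not (isEmpty (T r (n ∸ suc r)))) (rows n)
  ∧ allBoxes n (λ r c → not (isβδ (T r c)) ∨ all (λ c' → isEmpty (T r c')) (upTo c))
  ∧ allBoxes n (λ r c → not (isαγ (T r c)) ∨ all (λ r' → isEmpty (T r' c)) (upTo r))

closestRight : ℕ → Tab → ℕ → ℕ → Maybe Lab
closestRight n T r c = firstJust (map (T r) (range (suc c) (n ∸ r)))

closestBelow : ℕ → Tab → ℕ → ℕ → Maybe Lab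
closestBelow n T r c = firstJust (map (λ r' → T r' c) (range (suc r) (n ∸ c)))

rowIndex : ℕ → Tab → ℕ → Maybe Lab
rowIndex n T r = firstJust (map (T r) (colsOf n r))

count : {A : Set} → (A → Bool) → List A → ℕ
count p [] = 0
count p (x ∷ xs) = if p x then suc (count p xs) else count p xs

#δrows : ℕ → Tab → ℕ
#δrows n T = count (λ r → isδ (rowIndex n T r)) (rows n)

#αγrows : ℕ → Tab → ℕ
#αγrows n T = count (λ r → isαγ (rowIndex n T r)) (rows n)

at : {A : Set} → List (Maybe A) → ℕ → Maybe A
at [] _ = nothing
at (x ∷ _) zero = x
at (_ ∷ xs) (suc i) = at xs i

-- Adding a new column on the left: the new column is given by its entries
-- from top (row 0) to bottom (row n); the old tableau is shifted one column
-- to the right.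
addColumn : List (Maybe Lab) → Tab → Tab
addColumn col T r zero = at col r
addColumn col T r (suc c) = T r c

allColumns : ℕ → List (List (Maybe Lab))
allColumns zero = [] ∷ []
allColumns (suc m) =
  concatMap (λ xs → map (λ x → x ∷ xs) (nothing ∷ just α ∷ just β ∷ just γ ∷ just δ ∷ []))
            (allColumns m)

-- Weights and the D, E recursions, evaluated in an arbitrary commutative
-- semiring at arbitrary values of the parameters α β γ δ q (u = 1).

module Weights {c ℓ : Level} (R : CommutativeSemiring c ℓ)
               (a b g d q : CommutativeSemiring.Carrier R) where
  open CommutativeSemiring R

  labVal : Lab → Carrier
  labVal α = a
  labVal β = b
  labVal γ = g
  labVal δ = d

  boxWt : ℕ → Tab → ℕ → ℕ → Carrier
  boxWt n T r c with T r c
  ... | just x = labVal x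
  ... | nothing with closestRight n T r c
  ...   | just β = 1#
  ...   | just δ = q
  ...   | nothing = 1#
  ...   | just _ with closestBelow n T r c
  ...     | just α = 1#
  ...     | just δ = 1#
  ...     | just β = q
  ...     | just γ = q
  ...     | nothing = 1#

  prod : List Carrier → Carrier
  prod = foldr _*_ 1#

  sum : List Carrier → Carrier
  sum = foldr _+_ 0#

  wt : ℕ → Tab → Carrier
  wt n T = prod (concatMap (λ r → map (boxWt n T r) (colsOf n r)) (rows n))

  qpow : ℕ → Carrier
  qpow zero = 1#
  qpow (suc i) = q * qpow i

  mutual
    D : ℕ → ℕ → ℕ → ℕ → Carrier
    D i j zero l =
      if j <ᵇ i then 0#
      else if 1 <ᵇ l then 0#
      else if (j ≡ᵇ suc i) ∧ (l ≡ᵇ 0) then d * qpow i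
      else if (j ≡ᵇ i) ∧ (l ≡ᵇ 1) then a * qpow i
      else 0#
    D i j (suc k) l =
      if j <ᵇ i then 0#
      else if suc (suc k) <ᵇ l then 0#
      else (d * Dj-1 j + Dl-1 l)
      where
        Dj-1 : ℕ → Carrier
        Dj-1 zero = 0#
        Dj-1 (suc j') = D i j' k l + E i j' k l
        Dl-1 : ℕ → Carrier
        Dl-1 zero = 0#
        Dl-1 (suc l') = D i j k l'

    E : ℕ → ℕ → ℕ → ℕ → Carrier
    E i j zero l =
      if j <ᵇ i then 0#
      else if 1 <ᵇ l then 0#
      else if (j ≡ᵇ i) ∧ (l ≡ᵇ 0) then b * qpow i
      else if (j ≡ᵇ i) ∧ (l ≡ᵇ 1) then g * qpow i
      else 0#
    E i j (suc k) l =
      if j <ᵇ i then 0#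
      else if suc (suc k) <ᵇ l then 0#
      else (b * (D i j k l + E i j k l) + q * El-1 l)
      where
        El-1 : ℕ → Carrier
        El-1 zero = 0#
        El-1 (suc l') = E i j k l'

  columnSum : (Maybe Lab → Bool) → ℕ → Tab → ℕ → ℕ → Carrier
  columnSum bottom n T j l =
    sum (map (λ col →
              let T' = addColumn col T in
              if isStaircase (suc n) T' ∧ bottom (at col n)
                 ∧ (#δrows (suc n) T' ≡ᵇ j) ∧ (#αγrows (suc n) T' ≡ᵇ l)
              then wt (suc n) T' else 0#)
         (allColumns (suc n)))

module Submission where

-- Seen from the new column, only the indices of the rows of T matter: a row
-- of T is indexed by α/γ, β or δ, and below them the new column has its
-- diagonal box.  After finite sums (`SemiringSums`) and the recursions of D
-- and E without their guards (`Recurrences`), `ColumnValues` sums new columns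
-- over an abstract list of such row kinds and shows, by induction adding one
-- row directly above the diagonal box at a time, that these sums satisfy the
-- recursions: a β-row changes nothing, a δ-row contributes a factor q and a
-- δ-row, and an α/γ-row gives the two cases of the recursion in k.
-- `NewColumn`, `BoxWeights` and `TableauSums` identify the sums for T with the
-- abstract ones: T' is a staircase tableau iff the new column is valid for the
-- row kinds of T, wt(T') = wt(T)·(weight of the new column), and the row
-- counts agree.

open import Defs
open import Level using (Level; _⊔_)
open import Data.Bool using (Bool; true; false; _∧_; _∨_; not; if_then_else_)
open import Data.Maybe using (Maybe; just; nothing; _<∣>_)
open import Data.Maybe.Properties using (<∣>-identityʳ)
open import Data.Bool.Properties using (∧-assoc; ∧-identityʳ; ∧-zeroʳ; ∨-zeroʳ)
open import Data.Nat as ℕ using (ℕ; zero; suc; _∸_; _<ᵇ_; _≡ᵇ_)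
open import Data.Nat.Properties as ℕₚ using (suc-injective)
open import Algebra.Properties.CommutativeSemigroup ℕₚ.+-commutativeSemigroup
  using () renaming (x∙yz≈y∙xz to +-leftComm)
open import Data.List using (List; []; _∷_; _++_; _∷ʳ_; map; foldr; concatMap; length; applyUpTo)
open import Data.Product using (_×_; _,_; proj₁; proj₂)
open import Data.Empty using (⊥)
open import Data.List.Relation.Unary.All as All using (All; []; _∷_)
open import Data.List.Properties using (++-assoc; length-++-comm)
open import Data.List.Relation.Unary.All.Properties using (∷ʳ⁻)
open import Data.List.Reverse using (Reverse; []; _∶_∶ʳ_; reverseView)
open import Relation.Binary.PropositionalEquality as ≡ using (_≡_)
open import Algebra.Bundles using (CommutativeSemiring)

module SemiringSums {c ℓ : Level} (R : CommutativeSemiring c ℓ) where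
  open CommutativeSemiring R hiding (zero)
  open import Relation.Binary.Reasoning.Setoid setoid
  open import Algebra.Properties.CommutativeSemigroup +-commutativeSemigroup
    using () renaming (interchange to +-interchange)
  open import Algebra.Properties.CommutativeSemigroup *-commutativeSemigroup
    using () renaming (interchange to *-interchange)

  -- Σ_{x ∈ xs} f x; this unfolds to `Weights.sum (map f xs)`.
  sumOver : {A : Set} → (A → Carrier) → List A → Carrier
  sumOver f xs = foldr _+_ 0# (map f xs)

  sumOver-cong : {A : Set} {f h : A → Carrier} (xs : List A) →
                 (∀ x → f x ≈ h x) → sumOver f xs ≈ sumOver h xs
  sumOver-cong [] e = refl
  sumOver-cong (x ∷ xs) e = +-cong (e x) (sumOver-cong xs e)

  sumOver-zero : {A : Set} {f : A → Carrier} {xs : List A} → All (λ x → f x ≈ 0#) xs → sumOver f xs ≈ 0#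
  sumOver-zero [] = refl
  sumOver-zero (z ∷ zs) = trans (+-cong z (sumOver-zero zs)) (+-identityˡ 0#)

  sumOver-only : {A : Set} {f : A → Carrier} (pre : List A) (y₀ : A) (post : List A) →
                 All (λ y → f y ≈ 0#) (pre ++ post) → sumOver f (pre ++ y₀ ∷ post) ≈ f y₀
  sumOver-only [] y₀ post zs = trans (+-congˡ (sumOver-zero zs)) (+-identityʳ _)
  sumOver-only (p ∷ pre) y₀ post (z ∷ zs) = trans (+-cong z (sumOver-only pre y₀ post zs)) (+-identityˡ _)

  sumOver-++ : {A : Set} (f : A → Carrier) (xs ys : List A) →
               sumOver f (xs ++ ys) ≈ sumOver f xs + sumOver f ys
  sumOver-++ f [] ys = sym (+-identityˡ _)
  sumOver-++ f (x ∷ xs) ys = trans (+-congˡ (sumOver-++ f xs ys)) (sym (+-assoc _ _ _))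

  sumOver-concatMap : {A B : Set} (f : B → Carrier) (h : A → List B) (xs : List A) →
                      sumOver f (concatMap h xs) ≈ sumOver (λ x → sumOver f (h x)) xs
  sumOver-concatMap f h [] = refl
  sumOver-concatMap f h (x ∷ xs) =
    trans (sumOver-++ f (h x) (concatMap h xs)) (+-congˡ (sumOver-concatMap f h xs))

  sumOver-map : {A B : Set} (f : B → Carrier) (h : A → B) (xs : List A) →
                sumOver f (map h xs) ≡ sumOver (λ x → f (h x)) xs
  sumOver-map f h [] = ≡.refl
  sumOver-map f h (x ∷ xs) = ≡.cong (f (h x) +_) (sumOver-map f h xs)

  sumOver-+ : {A : Set} (f h : A → Carrier) (xs : List A) →
              sumOver (λ x → f x + h x) xs ≈ sumOver f xs + sumOver h xs
  sumOver-+ f h [] = sym (+-identityˡ 0#)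
  sumOver-+ f h (x ∷ xs) = trans (+-congˡ (sumOver-+ f h xs)) (+-interchange (f x) (h x) _ _)

  sumOver-*ˡ : {A : Set} (r : Carrier) (f : A → Carrier) (xs : List A) →
               sumOver (λ x → r * f x) xs ≈ r * sumOver f xs
  sumOver-*ˡ r f [] = sym (zeroʳ r)
  sumOver-*ˡ r f (x ∷ xs) = trans (+-congˡ (sumOver-*ˡ r f xs)) (sym (distribˡ r _ _))

  sumOver-swap : {A B : Set} (h : A → B → Carrier) (xs : List A) (ys : List B) →
                 sumOver (λ x → sumOver (h x) ys) xs ≈ sumOver (λ y → sumOver (λ x → h x y) xs) ys
  sumOver-swap h [] ys = sym (sumOver-zero (All.universal (λ _ → refl) ys))
  sumOver-swap h (x ∷ xs) ys =
    trans (+-congˡ (sumOver-swap h xs ys)) (sym (sumOver-+ (h x) (λ y → sumOver (λ x → h x y) xs) ys))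

  -- Products; `product` unfolds to `Weights.prod`.
  product : List Carrier → Carrier
  product = foldr _*_ 1#

  product-++ : ∀ xs ys → product (xs ++ ys) ≈ product xs * product ys
  product-++ [] ys = sym (*-identityˡ _)
  product-++ (x ∷ xs) ys = trans (*-congˡ (product-++ xs ys)) (sym (*-assoc _ _ _))

  product-concatMap : {A : Set} (h : A → List Carrier) (xs : List A) →
                      product (concatMap h xs) ≈ product (map (λ x → product (h x)) xs)
  product-concatMap h [] = refl
  product-concatMap h (x ∷ xs) =
    trans (product-++ (h x) (concatMap h xs)) (*-congˡ (product-concatMap h xs))

  product-* : {A : Set} (f h : A → Carrier) (xs : List A) →
              product (map (λ x → f x * h x) xs) ≈ product (map f xs) * product (map h xs)
  product-* f h [] = sym (*-identityˡ 1#)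
  product-* f h (x ∷ xs) = trans (*-congˡ (product-* f h xs)) (*-interchange (f x) (h x) _ _)

  product-cong : ∀ (f h : ℕ → Carrier) m → (∀ r → r ℕ.< m → f r ≈ h r) →
                 product (applyUpTo f m) ≈ product (applyUpTo h m)
  product-cong f h zero e = refl
  product-cong f h (suc m) e =
    *-cong (e 0 ℕ.z<s)
           (product-cong (λ r → f (suc r)) (λ r → h (suc r)) m (λ r r<m → e (suc r) (ℕ.s<s r<m)))

  -- The five possible contents of a box, in the order used by `allColumns`.
  contents : List (Maybe Lab)
  contents = nothing ∷ just α ∷ just β ∷ just γ ∷ just δ ∷ []

  sumContents : (Maybe Lab → Carrier) → Carrier
  sumContents f = sumOver f contents

  others : Maybe Lab → List (Maybe Lab)
  others nothing = just α ∷ just β ∷ just γ ∷ just δ ∷ []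
  others (just α) = nothing ∷ just β ∷ just γ ∷ just δ ∷ []
  others (just β) = nothing ∷ just α ∷ just γ ∷ just δ ∷ []
  others (just γ) = nothing ∷ just α ∷ just β ∷ just δ ∷ []
  others (just δ) = nothing ∷ just α ∷ just β ∷ just γ ∷ []

  sumContents-only : ∀ y₀ {f} → All (λ y → f y ≈ 0#) (others y₀) → sumContents f ≈ f y₀
  sumContents-only nothing = sumOver-only [] nothing _
  sumContents-only (just α) = sumOver-only (nothing ∷ []) (just α) _
  sumContents-only (just β) = sumOver-only (nothing ∷ just α ∷ []) (just β) _
  sumContents-only (just γ) = sumOver-only (nothing ∷ just α ∷ just β ∷ []) (just γ) _
  sumContents-only (just δ) = sumOver-only (nothing ∷ just α ∷ just β ∷ just γ ∷ []) (just δ) []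

  sumContents-split : ∀ {f h} → (∀ z → f (just z) ≈ h (just z)) → h nothing ≈ 0# →
                      sumContents f ≈ f nothing + sumContents h
  sumContents-split e h₀ = +-congˡ (trans labels (sym (trans (+-congʳ h₀) (+-identityˡ _))))
    where labels = +-cong (e α) (+-cong (e β) (+-cong (e γ) (+-cong (e δ) refl)))

  sumColumns : ℕ → (List (Maybe Lab) → Carrier) → Carrier
  sumColumns m f = sumOver f (allColumns m)

  sumColumns-top : ∀ m f → sumColumns (suc m) f ≈ sumColumns m (λ xs → sumContents (λ x → f (x ∷ xs)))
  sumColumns-top m f = trans (sumOver-concatMap f _ (allColumns m))
    (sumOver-cong (allColumns m) (λ xs → reflexive (sumOver-map f (λ x → x ∷ xs) contents)))

  sumColumns-bottom : ∀ m f →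
    sumColumns (suc m) f ≈ sumColumns m (λ ys → sumContents (λ x → f (ys ∷ʳ x)))
  sumColumns-bottom zero f = sumColumns-top zero f
  sumColumns-bottom (suc m) f = begin
    sumColumns (suc (suc m)) f
      ≈⟨ sumColumns-top (suc m) f ⟩
    sumColumns (suc m) (λ xs → sumContents (λ x → f (x ∷ xs)))
      ≈⟨ sumColumns-bottom m _ ⟩
    sumColumns m (λ ys → sumContents (λ y → sumContents (λ x → f (x ∷ (ys ∷ʳ y)))))
      ≈⟨ sumOver-cong (allColumns m) (λ ys →
           sumOver-swap (λ y x → f (x ∷ (ys ∷ʳ y))) contents contents) ⟩
    sumColumns m (λ ys → sumContents (λ x → sumContents (λ y → f ((x ∷ ys) ∷ʳ y))))
      ≈⟨ sym (sumColumns-top m _) ⟩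
    sumColumns (suc m) (λ zs → sumContents (λ y → f (zs ∷ʳ y))) ∎

  sumColumns-cong : ∀ m {f h} → (∀ xs → length xs ≡ m → f xs ≈ h xs) →
                    sumColumns m f ≈ sumColumns m h
  sumColumns-cong zero e = +-cong (e [] ≡.refl) refl
  sumColumns-cong (suc m) {f} {h} e = begin
    sumColumns (suc m) f
      ≈⟨ sumColumns-top m f ⟩
    sumColumns m (λ xs → sumContents (λ x → f (x ∷ xs)))
      ≈⟨ sumColumns-cong m (λ xs len → sumOver-cong contents (λ x → e (x ∷ xs) (≡.cong suc len))) ⟩
    sumColumns m (λ xs → sumContents (λ x → h (x ∷ xs)))
      ≈⟨ sym (sumColumns-top m h) ⟩
    sumColumns (suc m) h ∎

module Recurrences {c ℓ : Level} (R : CommutativeSemiring c ℓ)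
                   (a b g d q : CommutativeSemiring.Carrier R) where
  open CommutativeSemiring R hiding (zero)
  open Weights R a b g d q
  open import Relation.Binary.Reasoning.Setoid setoid
  open import Algebra.Properties.CommutativeSemigroup *-commutativeSemigroup
    using () renaming (x∙yz≈y∙xz to *-leftComm)

  private
    ∨-weakenˡ : ∀ {x y z} → (x ≡ true → y ≡ true) → x ∨ z ≡ true → y ∨ z ≡ true
    ∨-weakenˡ {true} f _ = ≡.cong (_∨ _) (f ≡.refl)
    ∨-weakenˡ {false} {y} f h = ≡.trans (≡.cong (y ∨_) h) (∨-zeroʳ y)

    ∨-weakenʳ : ∀ {x y z} → (y ≡ true → z ≡ true) → x ∨ y ≡ true → x ∨ z ≡ true
    ∨-weakenʳ {true} f _ = ≡.refl
    ∨-weakenʳ {false} f h = f h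

    <ᵇ-weaken : ∀ m n → (suc m <ᵇ n) ≡ true → (m <ᵇ n) ≡ true
    <ᵇ-weaken zero (suc n) _ = ≡.refl
    <ᵇ-weaken (suc m) (suc n) h = <ᵇ-weaken m n h

  prev : (ℕ → Carrier) → ℕ → Carrier
  prev f zero = 0#
  prev f (suc n) = f n

  prev-scale : ∀ r {f h : ℕ → Carrier} → (∀ n → f n ≈ r * h n) → ∀ m → prev f m ≈ r * prev h m
  prev-scale r e zero = sym (zeroʳ r)
  prev-scale r e (suc m) = e m

  prev-zero : ∀ m → prev (λ _ → 0#) m ≈ 0#
  prev-zero zero = refl
  prev-zero (suc m) = refl

  prev-cong : ∀ {f h : ℕ → Carrier} → (∀ n → f n ≈ h n) → ∀ m → prev f m ≈ prev h m
  prev-cong e zero = refl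
  prev-cong e (suc m) = e m

  -- (i, j, k, l) lies outside the region i ≤ j, l ≤ k + 1 where D and E can be nonzero.
  outside : ℕ → ℕ → ℕ → ℕ → Bool
  outside i j k l = (j <ᵇ i) ∨ (suc k <ᵇ l)

  guarded-zero : ∀ g₁ g₂ x → g₁ ∨ g₂ ≡ true → (if g₁ then 0# else if g₂ then 0# else x) ≡ 0#
  guarded-zero true g₂ x _ = ≡.refl
  guarded-zero false true x _ = ≡.refl

  unguard : ∀ g₁ g₂ {x} → (g₁ ∨ g₂ ≡ true → x ≈ 0#) →
            (if g₁ then 0# else if g₂ then 0# else x) ≈ x
  unguard true g₂ h = sym (h ≡.refl)
  unguard false true h = sym (h ≡.refl)
  unguard false false h = refl

  vanish : ∀ i j k l → outside i j k l ≡ true → (D i j k l ≈ 0#) × (E i j k l ≈ 0#)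
  vanish i j zero l h =
    reflexive (guarded-zero (j <ᵇ i) (1 <ᵇ l) _ h) , reflexive (guarded-zero (j <ᵇ i) (1 <ᵇ l) _ h)
  vanish i j (suc k) l h =
    reflexive (guarded-zero (j <ᵇ i) (suc (suc k) <ᵇ l) _ h) ,
    reflexive (guarded-zero (j <ᵇ i) (suc (suc k) <ᵇ l) _ h)

  DStep : ℕ → ℕ → ℕ → ℕ → Carrier
  DStep i j k l = d * prev (λ j' → D i j' k l + E i j' k l) j + prev (λ l' → D i j k l') l

  EStep : ℕ → ℕ → ℕ → ℕ → Carrier
  EStep i j k l = b * (D i j k l + E i j k l) + q * prev (λ l' → E i j k l') l

  private
    DE-vanish : ∀ i j k l → outside i j k l ≡ true → D i j k l + E i j k l ≈ 0#
    DE-vanish i j k l h = trans (+-cong (proj₁ (vanish i j k l h)) (proj₂ (vanish i j k l h))) (+-identityʳ 0#)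

    outside-weaken : ∀ i j k l → outside i j (suc k) l ≡ true → outside i j k l ≡ true
    outside-weaken i j k l = ∨-weakenʳ (<ᵇ-weaken (suc k) l)

  -- The guards of the recursions are redundant: the bodies vanish there too.
  DStep-vanish : ∀ i j k l → outside i j (suc k) l ≡ true → DStep i j k l ≈ 0#
  DStep-vanish i j k l h =
    trans (+-cong (trans (*-congˡ (lowered-j j h)) (zeroʳ d)) (lowered-l l h)) (+-identityʳ 0#)
    where
      lowered-j : ∀ j → outside i j (suc k) l ≡ true → prev (λ j' → D i j' k l + E i j' k l) j ≈ 0#
      lowered-j zero _ = refl
      lowered-j (suc j) h = DE-vanish i j k l (outside-weaken i j k l (∨-weakenˡ (<ᵇ-weaken j i) h))
      lowered-l : ∀ l → outside i j (suc k) l ≡ true → prev (λ l' → D i j k l') l ≈ 0#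
      lowered-l zero _ = refl
      lowered-l (suc l) h = proj₁ (vanish i j k l h)

  EStep-vanish : ∀ i j k l → outside i j (suc k) l ≡ true → EStep i j k l ≈ 0#
  EStep-vanish i j k l h =
    trans (+-cong (trans (*-congˡ (DE-vanish i j k l (outside-weaken i j k l h))) (zeroʳ b))
                  (trans (*-congˡ (lowered-l l h)) (zeroʳ q)))
          (+-identityʳ 0#)
    where
      lowered-l : ∀ l → outside i j (suc k) l ≡ true → prev (λ l' → E i j k l') l ≈ 0#
      lowered-l zero _ = refl
      lowered-l (suc l) h = proj₂ (vanish i j k l h)

  D-rec : ∀ i j k l → D i j (suc k) l ≈ DStep i j k l
  D-rec i zero k zero = unguard (0 <ᵇ i) false (DStep-vanish i zero k zero)
  D-rec i zero k (suc l) = unguard (0 <ᵇ i) (suc k <ᵇ l) (DStep-vanish i zero k (suc l))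
  D-rec i (suc j) k zero = unguard (suc j <ᵇ i) false (DStep-vanish i (suc j) k zero)
  D-rec i (suc j) k (suc l) = unguard (suc j <ᵇ i) (suc k <ᵇ l) (DStep-vanish i (suc j) k (suc l))

  E-rec : ∀ i j k l → E i j (suc k) l ≈ EStep i j k l
  E-rec i j k zero = unguard (j <ᵇ i) false (EStep-vanish i j k zero)
  E-rec i j k (suc l) = unguard (j <ᵇ i) (suc k <ᵇ l) (EStep-vanish i j k (suc l))

  private
    q-zero : 0# ≈ q * 0#
    q-zero = sym (zeroʳ q)

    if-scale : ∀ g {x y x' y'} → x' ≈ q * x → y' ≈ q * y →
               (if g then x' else y') ≈ q * (if g then x else y)
    if-scale true ex ey = ex
    if-scale false ex ey = ey

    pull-q : ∀ r x y → r * (q * x) + q * y ≈ q * (r * x + y)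
    pull-q r x y = trans (+-congʳ (*-leftComm r q x)) (sym (distribˡ q _ _))

  -- A row indexed by δ multiplies by q and raises j by one.
  D-shift : ∀ i j k l → (D (suc i) (suc j) k l ≈ q * D i j k l) × (E (suc i) (suc j) k l ≈ q * E i j k l)
  D-shift i j zero l =
    if-scale (j <ᵇ i) q-zero (if-scale (1 <ᵇ l) q-zero
      (if-scale ((j ≡ᵇ suc i) ∧ (l ≡ᵇ 0)) (*-leftComm d q _)
        (if-scale ((j ≡ᵇ i) ∧ (l ≡ᵇ 1)) (*-leftComm a q _) q-zero))) ,
    if-scale (j <ᵇ i) q-zero (if-scale (1 <ᵇ l) q-zero
      (if-scale ((j ≡ᵇ i) ∧ (l ≡ᵇ 0)) (*-leftComm b q _)
        (if-scale ((j ≡ᵇ i) ∧ (l ≡ᵇ 1)) (*-leftComm g q _) q-zero)))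
  D-shift i j (suc k) l = D-part , E-part
    where
      DE-shift : ∀ j → D (suc i) (suc j) k l + E (suc i) (suc j) k l ≈ q * (D i j k l + E i j k l)
      DE-shift j = trans (+-cong (proj₁ (D-shift i j k l)) (proj₂ (D-shift i j k l))) (sym (distribˡ q _ _))

      lowered-DE : ∀ j → prev (λ j' → D (suc i) j' k l + E (suc i) j' k l) (suc j)
                         ≈ q * prev (λ j' → D i j' k l + E i j' k l) j
      lowered-DE zero = trans (DE-vanish (suc i) zero k l ≡.refl) q-zero
      lowered-DE (suc j) = DE-shift j

      D-part : D (suc i) (suc j) (suc k) l ≈ q * D i j (suc k) l
      D-part = begin
        D (suc i) (suc j) (suc k) l
          ≈⟨ D-rec (suc i) (suc j) k l ⟩
        DStep (suc i) (suc j) k l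
          ≈⟨ +-cong (*-congˡ (lowered-DE j)) (prev-scale q (λ l' → proj₁ (D-shift i j k l')) l) ⟩
        d * (q * prev (λ j' → D i j' k l + E i j' k l) j) + q * prev (λ l' → D i j k l') l
          ≈⟨ pull-q d _ _ ⟩
        q * DStep i j k l
          ≈⟨ *-congˡ (sym (D-rec i j k l)) ⟩
        q * D i j (suc k) l ∎

      E-part : E (suc i) (suc j) (suc k) l ≈ q * E i j (suc k) l
      E-part = begin
        E (suc i) (suc j) (suc k) l
          ≈⟨ E-rec (suc i) (suc j) k l ⟩
        EStep (suc i) (suc j) k l
          ≈⟨ +-cong (*-congˡ (DE-shift j)) (*-congˡ (prev-scale q (λ l' → proj₂ (D-shift i j k l')) l)) ⟩
        b * (q * (D i j k l + E i j k l)) + q * (q * prev (λ l' → E i j k l') l)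
          ≈⟨ pull-q b _ _ ⟩
        q * EStep i j k l
          ≈⟨ *-congˡ (sym (E-rec i j k l)) ⟩
        q * E i j (suc k) l ∎

  D-δRow : ∀ i j k l → (prev (λ j' → q * D i j' k l) j ≈ D (suc i) j k l) ×
                       (prev (λ j' → q * E i j' k l) j ≈ E (suc i) j k l)
  D-δRow i zero k l =
    sym (proj₁ (vanish (suc i) zero k l ≡.refl)) , sym (proj₂ (vanish (suc i) zero k l ≡.refl))
  D-δRow i (suc j) k l = sym (proj₁ (D-shift i j k l)) , sym (proj₂ (D-shift i j k l))

-- The new column seen from the rows of the old tableau T of size n.  Rows
-- 0 … n-1 of T are indexed by α/γ, β or δ; row n of T' (its new diagonal box)
-- has no box in T.
data RowKind : Set where
  αγRow βRow δRow newRow : RowKind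

data Old : RowKind → Set where
  αγ-old : Old αγRow
  β-old : Old βRow
  δ-old : Old δRow

-- The new box of a row indexed by β or δ lies left of that label and must be
-- empty; the new diagonal box must be labelled.
admits : RowKind → Maybe Lab → Bool
admits αγRow _ = true
admits βRow y = isEmpty y
admits δRow y = isEmpty y
admits newRow y = not (isEmpty y)

-- The index of a row whose new box is empty (a representative label).
kindIndex : RowKind → Maybe Lab
kindIndex αγRow = just α
kindIndex βRow = just β
kindIndex δRow = just δ
kindIndex newRow = nothing

oneIf : Bool → ℕ
oneIf true = 1
oneIf false = 0

-- Number of rows whose index in T' (the new box, or else the old index) satisfies P.
countIndexed : (Maybe Lab → Bool) → List RowKind → List (Maybe Lab) → ℕ
countIndexed P (K ∷ ks) (y ∷ ys) = oneIf (P (y <∣> kindIndex K)) ℕ.+ countIndexed P ks ys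
countIndexed P _ _ = 0

-- A column is valid for the given rows, when all boxes above are empty iff p
-- holds: every box is admitted by its row, and an α/γ only occurs below empty boxes.
valid : List RowKind → Bool → List (Maybe Lab) → Bool
valid (K ∷ ks) p (y ∷ ys) = admits K y ∧ (not (isαγ y) ∨ p) ∧ valid ks (isEmpty y ∧ p) ys
valid [] _ [] = true
valid [] _ (_ ∷ _) = false
valid (_ ∷ _) _ [] = false

bottomOf : List (Maybe Lab) → Maybe Lab
bottomOf [] = nothing
bottomOf (x ∷ []) = x
bottomOf (_ ∷ y ∷ ys) = bottomOf (y ∷ ys)

bottomOf-++ : ∀ zs y ys → bottomOf (zs ++ y ∷ ys) ≡ bottomOf (y ∷ ys)
bottomOf-++ [] y ys = ≡.refl
bottomOf-++ (z ∷ []) y ys = ≡.refl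
bottomOf-++ (z ∷ z' ∷ zs) y ys = bottomOf-++ (z' ∷ zs) y ys

firstJust-++ : ∀ {A : Set} (zs ys : List (Maybe A)) → firstJust (zs ++ ys) ≡ firstJust zs <∣> firstJust ys
firstJust-++ [] ys = ≡.refl
firstJust-++ (just z ∷ zs) ys = ≡.refl
firstJust-++ (nothing ∷ zs) ys = firstJust-++ zs ys

count-∷ʳ : ∀ {A : Set} (p : A → Bool) xs x → count p (xs ∷ʳ x) ≡ oneIf (p x) ℕ.+ count p xs
count-∷ʳ p [] x with p x
... | true = ≡.refl
... | false = ≡.refl
count-∷ʳ p (y ∷ xs) x with p y
... | true = ≡.trans (≡.cong suc (count-∷ʳ p xs x)) (≡.sym (ℕₚ.+-suc (oneIf (p x)) _))
... | false = count-∷ʳ p xs x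

valid-prefix : ∀ {ku ku' u u' e} → (∀ p → valid ku p u ≡ valid ku' p u' ∧ e) →
  ∀ ks zs p → length zs ≡ length ks → valid (ks ++ ku) p (zs ++ u) ≡ valid (ks ++ ku') p (zs ++ u') ∧ e
valid-prefix h [] [] p _ = h p
valid-prefix {e = e} h (K ∷ ks) (y ∷ zs) p len =
  ≡.trans (≡.cong (λ v → admits K y ∧ (not (isαγ y) ∨ p) ∧ v) (valid-prefix h ks zs _ (suc-injective len)))
    (≡.sym (≡.trans (∧-assoc (admits K y) _ e)
                    (≡.cong (admits K y ∧_) (∧-assoc (not (isαγ y) ∨ p) _ e))))

count-prefix : ∀ P {ku ku' u u' A} → countIndexed P ku u ≡ A ℕ.+ countIndexed P ku' u' →
  ∀ ks zs → length zs ≡ length ks →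
  countIndexed P (ks ++ ku) (zs ++ u) ≡ A ℕ.+ countIndexed P (ks ++ ku') (zs ++ u')
count-prefix P h [] [] _ = h
count-prefix P {A = A} h (K ∷ ks) (y ∷ zs) len =
  ≡.trans (≡.cong (oneIf (P (y <∣> kindIndex K)) ℕ.+_) (count-prefix P h ks zs (suc-injective len)))
          (+-leftComm (oneIf (P (y <∣> kindIndex K))) A _)

valid-emptyAbove : ∀ {K} → Old K → ∀ p x →
  valid (K ∷ newRow ∷ []) p (nothing ∷ x ∷ []) ≡ valid (newRow ∷ []) p (x ∷ []) ∧ true
valid-emptyAbove αγ-old p x = ≡.sym (∧-identityʳ _)
valid-emptyAbove β-old p x = ≡.sym (∧-identityʳ _)
valid-emptyAbove δ-old p x = ≡.sym (∧-identityʳ _)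

-- Below a labelled box the new diagonal box must be β or δ.
valid-labelAbove : ∀ x → valid (newRow ∷ []) false (x ∷ []) ≡ isβδ x
valid-labelAbove nothing = ≡.refl
valid-labelAbove (just α) = ≡.refl
valid-labelAbove (just β) = ≡.refl
valid-labelAbove (just γ) = ≡.refl
valid-labelAbove (just δ) = ≡.refl

module ColumnValues {c ℓ : Level} (R : CommutativeSemiring c ℓ)
                    (a b g d q : CommutativeSemiring.Carrier R) where
  open CommutativeSemiring R hiding (zero)
  open Weights R a b g d q using (labVal; D; E)
  open SemiringSums R
  open Recurrences R a b g d q
  open import Algebra.Properties.CommutativeSemigroup *-commutativeSemigroup
    using () renaming (x∙yz≈y∙xz to *-leftComm)

  -- Weight of an empty new box, given the closest label below it; the closest
  -- label to its right is the index of its row.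
  emptyWt : RowKind → Maybe Lab → Carrier
  emptyWt αγRow below = if isβγ below then q else 1#
  emptyWt βRow _ = 1#
  emptyWt δRow _ = q
  emptyWt newRow _ = 1#

  cellWt : RowKind → Maybe Lab → Maybe Lab → Carrier
  cellWt K (just z) _ = labVal z
  cellWt K nothing below = emptyWt K below

  weight : List RowKind → List (Maybe Lab) → Carrier
  weight (K ∷ ks) (y ∷ ys) = cellWt K y (firstJust ys) * weight ks ys
  weight _ _ = 1#

  -- Contribution of a column to the sums of the lemma: its weight, provided it
  -- is valid, its bottom box satisfies `bottom`, and T' has j rows indexed by δ
  -- and l rows indexed by α/γ, counting A resp. B additional such rows.
  countsMatch : List RowKind → ℕ → ℕ → ℕ → ℕ → List (Maybe Lab) → Bool
  countsMatch ks A B j l col =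
    (A ℕ.+ countIndexed isδ ks col ≡ᵇ j) ∧ (B ℕ.+ countIndexed isαγ ks col ≡ᵇ l)

  colValue : (Maybe Lab → Bool) → List RowKind → ℕ → ℕ → ℕ → ℕ → List (Maybe Lab) → Carrier
  colValue bottom ks A B j l col =
    if valid ks true col ∧ bottom (bottomOf col) ∧ countsMatch ks A B j l col then weight ks col else 0#

  if-cong : ∀ {t t'} {x x' : Carrier} → t ≡ t' → x ≈ x' →
            (if t then x else 0#) ≈ (if t' then x' else 0#)
  if-cong {true} ≡.refl e = e
  if-cong {false} ≡.refl e = refl

  if-false : ∀ {t} {x : Carrier} → t ≡ false → (if t then x else 0#) ≈ 0#
  if-false ≡.refl = refl

  if-*ˡ : ∀ t r x → (if t then r * x else 0#) ≈ r * (if t then x else 0#)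
  if-*ˡ true r x = refl
  if-*ˡ false r x = sym (zeroʳ r)

  weight-prefix : ∀ {ku ku' u u' r} → firstJust u ≡ firstJust u' → weight ku u ≈ r * weight ku' u' →
    ∀ ks zs → length zs ≡ length ks → weight (ks ++ ku) (zs ++ u) ≈ r * weight (ks ++ ku') (zs ++ u')
  weight-prefix same h [] [] _ = h
  weight-prefix {u = u} {u'} same h (K ∷ ks) (y ∷ zs) len =
    trans (*-cong (reflexive (≡.cong (cellWt K y) first)) (weight-prefix same h ks zs (suc-injective len)))
          (*-leftComm _ _ _)
    where
      first : firstJust (zs ++ u) ≡ firstJust (zs ++ u')
      first = ≡.trans (firstJust-++ zs u)
                      (≡.trans (≡.cong (firstJust zs <∣>_) same) (≡.sym (firstJust-++ zs u')))

  -- The lower part u of a column (rows ku) behaves like u' (rows ku') as seen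
  -- from the boxes above, up to an extra validity condition, a weight factor,
  -- and extra δ- and α/γ-rows.
  record Replaces (ku : List RowKind) (u : List (Maybe Lab)) (ku' : List RowKind) (u' : List (Maybe Lab))
                  : Set (c ⊔ ℓ) where
    field
      condition : Bool
      factor : Carrier
      extraδ extraαγ : ℕ
      sameFirst : firstJust u ≡ firstJust u'
      validity : ∀ p → valid ku p u ≡ valid ku' p u' ∧ condition
      weighting : weight ku u ≈ factor * weight ku' u'
      countδ : countIndexed isδ ku u ≡ extraδ ℕ.+ countIndexed isδ ku' u'
      countαγ : countIndexed isαγ ku u ≡ extraαγ ℕ.+ countIndexed isαγ ku' u'

  colValue-replace : ∀ {ku u ku' u'} (ρ : Replaces ku u ku' u') bottom ks zs j l → length zs ≡ length ks →
    let open Replaces ρ in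
    colValue bottom (ks ++ ku) 0 0 j l (zs ++ u) ≈
    (if (valid (ks ++ ku') true (zs ++ u') ∧ condition) ∧ bottom (bottomOf (zs ++ u))
          ∧ (extraδ ℕ.+ countIndexed isδ (ks ++ ku') (zs ++ u') ≡ᵇ j)
          ∧ (extraαγ ℕ.+ countIndexed isαγ (ks ++ ku') (zs ++ u') ≡ᵇ l)
     then factor * weight (ks ++ ku') (zs ++ u') else 0#)
  colValue-replace {ku} {u} {ku'} {u'} ρ bottom ks zs j l len = if-cong
    (≡.cong₂ (λ v w → v ∧ bottom (bottomOf (zs ++ _)) ∧ w) (valid-prefix validity ks zs true len)
      (≡.cong₂ (λ x y → (x ≡ᵇ j) ∧ (y ≡ᵇ l))
               (count-prefix isδ {ku} {ku'} {u} {u'} {extraδ} countδ ks zs len)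
               (count-prefix isαγ {ku} {ku'} {u} {u'} {extraαγ} countαγ ks zs len)))
    (weight-prefix sameFirst weighting ks zs len)
    where open Replaces ρ

  private
    reorder : ∀ s t u → s ∧ (t ∧ u) ≡ (t ∧ true) ∧ (s ∧ u)
    reorder true true u = ≡.refl
    reorder true false u = ≡.refl
    reorder false true u = ≡.refl
    reorder false false u = ≡.refl

    if-split : ∀ v e t C r w →
      (if (v ∧ e) ∧ t ∧ C then r * w else 0#) ≈ (if e ∧ t then r else 0#) * (if v ∧ true ∧ C then w else 0#)
    if-split false e t C r w = sym (zeroʳ _)
    if-split true false t C r w = sym (zeroˡ _)
    if-split true true false C r w = sym (zeroˡ _)
    if-split true true true C r w = if-*ˡ C r w

  peel-empty : ∀ {K} → Old K → ∀ bottom ks zs x j l → length zs ≡ length ks →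
    colValue bottom (ks ++ K ∷ newRow ∷ []) 0 0 j l (zs ++ nothing ∷ x ∷ []) ≈
    emptyWt K (firstJust (x ∷ [])) *
    colValue bottom (ks ++ newRow ∷ []) (oneIf (isδ (kindIndex K))) (oneIf (isαγ (kindIndex K))) j l (zs ++ x ∷ [])
  peel-empty {K} old bottom ks zs x j l len =
    trans (colValue-replace ρ bottom ks zs j l len)
      (trans (if-cong (≡.cong₂ (λ v w → v ∧ bottom w ∧ C) (∧-identityʳ v) bottoms) refl)
             (if-*ˡ (v ∧ bottom (bottomOf (zs ++ x ∷ [])) ∧ C) _ (weight ks' (zs ++ x ∷ []))))
    where
      ks' = ks ++ newRow ∷ []
      v = valid ks' true (zs ++ x ∷ [])
      C = (oneIf (isδ (kindIndex K)) ℕ.+ countIndexed isδ ks' (zs ++ x ∷ []) ≡ᵇ j)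
          ∧ (oneIf (isαγ (kindIndex K)) ℕ.+ countIndexed isαγ ks' (zs ++ x ∷ []) ≡ᵇ l)

      bottoms : bottomOf (zs ++ nothing ∷ x ∷ []) ≡ bottomOf (zs ++ x ∷ [])
      bottoms = ≡.trans (bottomOf-++ zs nothing (x ∷ [])) (≡.sym (bottomOf-++ zs x []))

      ρ : Replaces (K ∷ newRow ∷ []) (nothing ∷ x ∷ []) (newRow ∷ []) (x ∷ [])
      ρ = record
        { condition = true ; factor = emptyWt K (firstJust (x ∷ []))
        ; extraδ = oneIf (isδ (kindIndex K)) ; extraαγ = oneIf (isαγ (kindIndex K))
        ; sameFirst = ≡.refl ; validity = λ p → valid-emptyAbove old p x ; weighting = refl
        ; countδ = ≡.refl ; countαγ = ≡.refl }

  -- A label z directly above the new diagonal box x: x must be β or δ, its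
  -- weight factors out, and z takes over the role of the bottom box.
  peel-label : ∀ K z bottom ks zs x j l → length zs ≡ length ks →
    colValue bottom (ks ++ K ∷ newRow ∷ []) 0 0 j l (zs ++ just z ∷ x ∷ []) ≈
    (if (admits K (just z) ∧ isβδ x) ∧ bottom x then cellWt newRow x nothing else 0#) *
    colValue (λ _ → true) (ks ++ newRow ∷ []) (oneIf (isδ x)) (oneIf (isαγ x)) j l (zs ++ just z ∷ [])
  peel-label K z bottom ks zs x j l len =
    trans (colValue-replace ρ bottom ks zs j l len)
      (trans (if-cong (≡.cong (λ w → (v ∧ e) ∧ bottom w ∧ C) (bottomOf-++ zs (just z) (x ∷ []))) refl)
             (if-split v e (bottom x) C (cellWt newRow x nothing) (weight ks' (zs ++ just z ∷ []))))
    where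
      ks' = ks ++ newRow ∷ []
      v = valid ks' true (zs ++ just z ∷ [])
      e = admits K (just z) ∧ isβδ x
      C = (oneIf (isδ x) ℕ.+ countIndexed isδ ks' (zs ++ just z ∷ []) ≡ᵇ j)
          ∧ (oneIf (isαγ x) ℕ.+ countIndexed isαγ ks' (zs ++ just z ∷ []) ≡ᵇ l)

      counts : ∀ P → countIndexed P (K ∷ newRow ∷ []) (just z ∷ x ∷ []) ≡
                     oneIf (P x) ℕ.+ countIndexed P (newRow ∷ []) (just z ∷ [])
      counts P = ≡.trans (≡.cong (λ t → oneIf (P (just z)) ℕ.+ (oneIf (P t) ℕ.+ 0)) (<∣>-identityʳ x))
                         (+-leftComm (oneIf (P (just z))) (oneIf (P x)) 0)

      ρ : Replaces (K ∷ newRow ∷ []) (just z ∷ x ∷ []) (newRow ∷ []) (just z ∷ [])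
      ρ = record
        { condition = e ; factor = cellWt newRow x nothing
        ; extraδ = oneIf (isδ x) ; extraαγ = oneIf (isαγ x)
        ; sameFirst = ≡.refl
        ; validity = λ p →
            ≡.trans (≡.cong (λ t → admits K (just z) ∧ (not (isαγ (just z)) ∨ p) ∧ t) (valid-labelAbove x))
                    (reorder (admits K (just z)) _ (isβδ x))
        ; weighting = *-leftComm (labVal z) _ _
        ; countδ = counts isδ ; countαγ = counts isαγ }

  colValue-wrongBottom : ∀ bottom ks A B j l col → bottom (bottomOf col) ≡ false →
                         colValue bottom ks A B j l col ≈ 0#
  colValue-wrongBottom bottom ks A B j l col h =
    if-false (≡.trans (≡.cong (λ t → valid ks true col ∧ t ∧ countsMatch ks A B j l col) h)
                      (∧-zeroʳ (valid ks true col)))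

  colValue-extraδ : ∀ bottom ks B j l col →
                    colValue bottom ks 1 B j l col ≈ prev (λ j' → colValue bottom ks 0 B j' l col) j
  colValue-extraδ bottom ks B zero l col =
    if-false (≡.trans (≡.cong (valid ks true col ∧_) (∧-zeroʳ (bottom (bottomOf col))))
                      (∧-zeroʳ (valid ks true col)))
  colValue-extraδ bottom ks B (suc j) l col = refl

  colValue-extraαγ : ∀ bottom ks A j l col →
                     colValue bottom ks A 1 j l col ≈ prev (λ l' → colValue bottom ks A 0 j l' col) l
  colValue-extraαγ bottom ks A j zero col =
    if-false (≡.trans (≡.cong (λ t → valid ks true col ∧ bottom (bottomOf col) ∧ t) (∧-zeroʳ _))
               (≡.trans (≡.cong (valid ks true col ∧_) (∧-zeroʳ (bottom (bottomOf col))))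
                        (∧-zeroʳ (valid ks true col))))
  colValue-extraαγ bottom ks A j (suc l) col = refl

  colValue-anyBottom : ∀ ks A B j l col z → bottomOf col ≡ just z →
    colValue (λ _ → true) ks A B j l col ≈ colValue isαδ ks A B j l col + colValue isβγ ks A B j l col
  colValue-anyBottom ks A B j l col z h =
    trans (split (valid ks true col) C (weight ks col) z)
          (+-cong (if-cong (≡.cong (λ t → valid ks true col ∧ isαδ t ∧ C) (≡.sym h)) refl)
                  (if-cong (≡.cong (λ t → valid ks true col ∧ isβγ t ∧ C) (≡.sym h)) refl))
    where
      C = countsMatch ks A B j l col

      split : ∀ v C x z → (if v ∧ true ∧ C then x else 0#) ≈
              (if v ∧ isαδ (just z) ∧ C then x else 0#) + (if v ∧ isβγ (just z) ∧ C then x else 0#)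
      split false C x z = sym (+-identityˡ 0#)
      split true C x α = sym (+-identityʳ _)
      split true C x δ = sym (+-identityʳ _)
      split true C x β = sym (+-identityˡ _)
      split true C x γ = sym (+-identityˡ _)

  sumOver-prev : {A : Set} (F : A → ℕ → Carrier) (xs : List A) (m : ℕ) →
                 sumOver (λ x → prev (F x) m) xs ≈ prev (λ n → sumOver (λ x → F x n) xs) m
  sumOver-prev F xs zero = sumOver-zero (All.universal (λ _ → refl) xs)
  sumOver-prev F xs (suc m) = refl

  module Lowest (ks : List RowKind) (zs : List (Maybe Lab)) where
    lowest : (Maybe Lab → Bool) → ℕ → ℕ → ℕ → ℕ → Maybe Lab → Carrier
    lowest bottom A B j l x = colValue bottom (ks ++ newRow ∷ []) A B j l (zs ++ x ∷ [])

    lowestAny : ℕ → ℕ → Maybe Lab → Carrier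
    lowestAny j l x = lowest isαδ 0 0 j l x + lowest isβγ 0 0 j l x

    oneLowest : (Maybe Lab → Bool) → ℕ → ℕ → Carrier
    oneLowest bottom j l = sumContents (lowest bottom 0 0 j l)

    twoLowest : RowKind → (Maybe Lab → Bool) → ℕ → ℕ → Maybe Lab → Carrier
    twoLowest K bottom j l y =
      sumContents (λ x → colValue bottom (ks ++ K ∷ newRow ∷ []) 0 0 j l (zs ++ y ∷ x ∷ []))

  module Peel (ks : List RowKind) (zs : List (Maybe Lab)) (len : length zs ≡ length ks) where
    open Lowest ks zs
    open import Relation.Binary.Reasoning.Setoid setoid

    lowest-wrongBottom : ∀ bottom A B j l x → bottom x ≡ false → lowest bottom A B j l x ≈ 0#
    lowest-wrongBottom bottom A B j l x h =
      colValue-wrongBottom bottom (ks ++ newRow ∷ []) A B j l (zs ++ x ∷ [])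
                           (≡.trans (≡.cong bottom (bottomOf-++ zs x [])) h)

    lowestAny-empty : ∀ j l → lowestAny j l nothing ≈ 0#
    lowestAny-empty j l = trans (+-cong (lowest-wrongBottom isαδ 0 0 j l nothing ≡.refl)
                                        (lowest-wrongBottom isβγ 0 0 j l nothing ≡.refl)) (+-identityʳ 0#)

    lowest-anyBottom : ∀ j l z → lowest (λ _ → true) 0 0 j l (just z) ≈ lowestAny j l (just z)
    lowest-anyBottom j l z =
      colValue-anyBottom (ks ++ newRow ∷ []) 0 0 j l (zs ++ just z ∷ []) z (bottomOf-++ zs (just z) [])

    oneLowest-any : ∀ j l → sumContents (lowestAny j l) ≈ oneLowest isαδ j l + oneLowest isβγ j l
    oneLowest-any j l = sumOver-+ (lowest isαδ 0 0 j l) (lowest isβγ 0 0 j l) contents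

    twoLowest-unlabelled : ∀ K bottom j l → (∀ z → admits K (just z) ≡ false) →
                           sumContents (twoLowest K bottom j l) ≈ twoLowest K bottom j l nothing
    twoLowest-unlabelled K bottom j l h =
      sumContents-only nothing {twoLowest K bottom j l} (none α ∷ none β ∷ none γ ∷ none δ ∷ [])
      where
        none : ∀ z → twoLowest K bottom j l (just z) ≈ 0#
        none z = sumOver-zero (All.universal (λ x →
          trans (peel-label K z bottom ks zs x j l len)
                (trans (*-congʳ (if-false (≡.cong (λ t → (t ∧ isβδ x) ∧ bottom x) (h z)))) (zeroˡ _))) contents)

    peel-β : ∀ bottom j l → sumContents (twoLowest βRow bottom j l) ≈ oneLowest bottom j l
    peel-β bottom j l = trans (twoLowest-unlabelled βRow bottom j l (λ _ → ≡.refl))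
      (sumOver-cong contents (λ x → trans (peel-empty β-old bottom ks zs x j l len) (*-identityˡ _)))

    sum-extraδ : ∀ bottom j l →
                 sumContents (lowest bottom 1 0 j l) ≈ prev (λ j' → oneLowest bottom j' l) j
    sum-extraδ bottom j l =
      trans (sumOver-cong contents (λ x → colValue-extraδ bottom (ks ++ newRow ∷ []) 0 j l (zs ++ x ∷ [])))
            (sumOver-prev (λ x j' → lowest bottom 0 0 j' l x) contents j)

    sum-extraαγ : ∀ bottom j l →
                  sumContents (lowest bottom 0 1 j l) ≈ prev (λ l' → oneLowest bottom j l') l
    sum-extraαγ bottom j l =
      trans (sumOver-cong contents (λ x → colValue-extraαγ bottom (ks ++ newRow ∷ []) 0 j l (zs ++ x ∷ [])))
            (sumOver-prev (λ x l' → lowest bottom 0 0 j l' x) contents l)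

    peel-δ : ∀ bottom j l →
             sumContents (twoLowest δRow bottom j l) ≈ prev (λ j' → q * oneLowest bottom j' l) j
    peel-δ bottom j l = begin
      sumContents (twoLowest δRow bottom j l)
        ≈⟨ twoLowest-unlabelled δRow bottom j l (λ _ → ≡.refl) ⟩
      twoLowest δRow bottom j l nothing
        ≈⟨ sumOver-cong contents (λ x → peel-empty δ-old bottom ks zs x j l len) ⟩
      sumContents (λ x → q * lowest bottom 1 0 j l x)
        ≈⟨ sumOver-*ˡ q (lowest bottom 1 0 j l) contents ⟩
      q * sumContents (lowest bottom 1 0 j l)
        ≈⟨ *-congˡ (sum-extraδ bottom j l) ⟩
      q * prev (λ j' → oneLowest bottom j' l) j
        ≈⟨ sym (prev-scale q (λ _ → refl) j) ⟩
      prev (λ j' → q * oneLowest bottom j' l) j ∎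

    private
      zero-scale : ∀ r s {x} → x ≈ 0# → r * x ≈ s * x
      zero-scale r s e = trans (*-congˡ e) (trans (zeroʳ r) (sym (trans (*-congˡ e) (zeroʳ s))))

    -- In a row indexed by α/γ, an empty box keeps the α/γ-row; its weight is q
    -- exactly when the diagonal box below it is β or γ.
    emptyAbove-αδ : ∀ j l x →
      colValue isαδ (ks ++ αγRow ∷ newRow ∷ []) 0 0 j l (zs ++ nothing ∷ x ∷ []) ≈ lowest isαδ 0 1 j l x
    emptyAbove-αδ j l x = trans (peel-empty αγ-old isαδ ks zs x j l len) (unit x)
      where
        unit : ∀ x → emptyWt αγRow (firstJust (x ∷ [])) * lowest isαδ 0 1 j l x ≈ lowest isαδ 0 1 j l x
        unit nothing = *-identityˡ _
        unit (just α) = *-identityˡ _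
        unit (just δ) = *-identityˡ _
        unit (just β) = trans (zero-scale q 1# (lowest-wrongBottom isαδ 0 1 j l (just β) ≡.refl)) (*-identityˡ _)
        unit (just γ) = trans (zero-scale q 1# (lowest-wrongBottom isαδ 0 1 j l (just γ) ≡.refl)) (*-identityˡ _)

    emptyAbove-βγ : ∀ j l x →
      colValue isβγ (ks ++ αγRow ∷ newRow ∷ []) 0 0 j l (zs ++ nothing ∷ x ∷ []) ≈ q * lowest isβγ 0 1 j l x
    emptyAbove-βγ j l x = trans (peel-empty αγ-old isβγ ks zs x j l len) (factor-q x)
      where
        factor-q : ∀ x → emptyWt αγRow (firstJust (x ∷ [])) * lowest isβγ 0 1 j l x ≈
                         q * lowest isβγ 0 1 j l x
        factor-q nothing = zero-scale 1# q (lowest-wrongBottom isβγ 0 1 j l nothing ≡.refl)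
        factor-q (just α) = zero-scale 1# q (lowest-wrongBottom isβγ 0 1 j l (just α) ≡.refl)
        factor-q (just δ) = zero-scale 1# q (lowest-wrongBottom isβγ 0 1 j l (just δ) ≡.refl)
        factor-q (just β) = refl
        factor-q (just γ) = refl

    -- A label z in a row indexed by α/γ sits above a diagonal δ (for bottom α/δ)
    -- or β (for bottom β/γ), and z becomes the effective bottom box.
    labelAbove-αδ : ∀ j l z →
                    twoLowest αγRow isαδ j l (just z) ≈ d * prev (λ j' → lowestAny j' l (just z)) j
    labelAbove-αδ j l z = begin
      twoLowest αγRow isαδ j l (just z)
        ≈⟨ sumOver-cong contents (λ x → peel-label αγRow z isαδ ks zs x j l len) ⟩
      sumContents (labelled isαδ)
        ≈⟨ sumContents-only (just δ) {labelled isαδ} (zeroˡ _ ∷ zeroˡ _ ∷ zeroˡ _ ∷ zeroˡ _ ∷ []) ⟩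
      d * colValue (λ _ → true) (ks ++ newRow ∷ []) 1 0 j l (zs ++ just z ∷ [])
        ≈⟨ *-congˡ (colValue-extraδ (λ _ → true) (ks ++ newRow ∷ []) 0 j l (zs ++ just z ∷ [])) ⟩
      d * prev (λ j' → lowest (λ _ → true) 0 0 j' l (just z)) j
        ≈⟨ *-congˡ (prev-cong (λ j' → lowest-anyBottom j' l z) j) ⟩
      d * prev (λ j' → lowestAny j' l (just z)) j ∎
      where
        labelled : (Maybe Lab → Bool) → Maybe Lab → Carrier
        labelled bottom x = (if isβδ x ∧ bottom x then cellWt newRow x nothing else 0#) *
          colValue (λ _ → true) (ks ++ newRow ∷ []) (oneIf (isδ x)) (oneIf (isαγ x)) j l (zs ++ just z ∷ [])

    labelAbove-βγ : ∀ j l z → twoLowest αγRow isβγ j l (just z) ≈ b * lowestAny j l (just z)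
    labelAbove-βγ j l z = begin
      twoLowest αγRow isβγ j l (just z)
        ≈⟨ sumOver-cong contents (λ x → peel-label αγRow z isβγ ks zs x j l len) ⟩
      sumContents (labelled isβγ)
        ≈⟨ sumContents-only (just β) {labelled isβγ} (zeroˡ _ ∷ zeroˡ _ ∷ zeroˡ _ ∷ zeroˡ _ ∷ []) ⟩
      b * lowest (λ _ → true) 0 0 j l (just z)
        ≈⟨ *-congˡ (lowest-anyBottom j l z) ⟩
      b * lowestAny j l (just z) ∎
      where
        labelled : (Maybe Lab → Bool) → Maybe Lab → Carrier
        labelled bottom x = (if isβδ x ∧ bottom x then cellWt newRow x nothing else 0#) *
          colValue (λ _ → true) (ks ++ newRow ∷ []) (oneIf (isδ x)) (oneIf (isαγ x)) j l (zs ++ just z ∷ [])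

    peel-αγ-D : ∀ j l → sumContents (twoLowest αγRow isαδ j l) ≈
                d * prev (λ j' → oneLowest isαδ j' l + oneLowest isβγ j' l) j
                + prev (λ l' → oneLowest isαδ j l') l
    peel-αγ-D j l = begin
      sumContents (twoLowest αγRow isαδ j l)
        ≈⟨ sumContents-split {twoLowest αγRow isαδ j l} {λ y → d * prev (λ j' → lowestAny j' l y) j}
             (labelAbove-αδ j l)
             (trans (*-congˡ (trans (prev-cong (λ j' → lowestAny-empty j' l) j) (prev-zero j))) (zeroʳ d)) ⟩
      twoLowest αγRow isαδ j l nothing + sumContents (λ y → d * prev (λ j' → lowestAny j' l y) j)
        ≈⟨ +-cong (trans (sumOver-cong contents (emptyAbove-αδ j l)) (sum-extraαγ isαδ j l))
                  (trans (sumOver-*ˡ d (λ y → prev (λ j' → lowestAny j' l y) j) contents)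
                         (*-congˡ (trans (sumOver-prev (λ y j' → lowestAny j' l y) contents j)
                                         (prev-cong (λ j' → oneLowest-any j' l) j)))) ⟩
      prev (λ l' → oneLowest isαδ j l') l + d * prev (λ j' → oneLowest isαδ j' l + oneLowest isβγ j' l) j
        ≈⟨ +-comm _ _ ⟩
      d * prev (λ j' → oneLowest isαδ j' l + oneLowest isβγ j' l) j + prev (λ l' → oneLowest isαδ j l') l ∎

    peel-αγ-E : ∀ j l → sumContents (twoLowest αγRow isβγ j l) ≈
                b * (oneLowest isαδ j l + oneLowest isβγ j l) + q * prev (λ l' → oneLowest isβγ j l') l
    peel-αγ-E j l = begin
      sumContents (twoLowest αγRow isβγ j l)
        ≈⟨ sumContents-split {twoLowest αγRow isβγ j l} {λ y → b * lowestAny j l y} (labelAbove-βγ j l)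
             (trans (*-congˡ (lowestAny-empty j l)) (zeroʳ b)) ⟩
      twoLowest αγRow isβγ j l nothing + sumContents (λ y → b * lowestAny j l y)
        ≈⟨ +-cong (trans (sumOver-cong contents (emptyAbove-βγ j l))
                         (trans (sumOver-*ˡ q (lowest isβγ 0 1 j l) contents)
                                (*-congˡ (sum-extraαγ isβγ j l))))
                  (trans (sumOver-*ˡ b (lowestAny j l) contents) (*-congˡ (oneLowest-any j l))) ⟩
      q * prev (λ l' → oneLowest isβγ j l') l + b * (oneLowest isαδ j l + oneLowest isβγ j l)
        ≈⟨ +-comm _ _ ⟩
      b * (oneLowest isαδ j l + oneLowest isβγ j l) + q * prev (λ l' → oneLowest isβγ j l') l ∎

  #δ #αγ : List RowKind → ℕ
  #δ old = count (λ K → isδ (kindIndex K)) old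
  #αγ old = count (λ K → isαγ (kindIndex K)) old

  rowSum : (Maybe Lab → Bool) → List RowKind → ℕ → ℕ → Carrier
  rowSum bottom old j l = sumColumns (suc (length old)) (colValue bottom (old ++ newRow ∷ []) 0 0 j l)

  Agrees : List RowKind → Set ℓ
  Agrees old = ∀ j l → (rowSum isαδ old j l ≈ D (#δ old) j (#αγ old) l) ×
                       (rowSum isβγ old j l ≈ E (#δ old) j (#αγ old) l)

  private
    single : (Maybe Lab → Bool) → ℕ → ℕ → Maybe Lab → Carrier
    single bottom j l x = colValue bottom (newRow ∷ []) 0 0 j l (x ∷ [])

    none : ∀ bottom j l → All (λ y → single bottom j l y ≈ 0#) contents → rowSum bottom [] j l ≈ 0#
    none bottom j l = sumOver-zero

  -- Without old rows the new column is a single diagonal box, and D_{0,j,0,l},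
  -- E_{0,j,0,l} are the weights of its possible labels.
  noRows : Agrees []
  noRows zero zero =
      none isαδ 0 0 (refl ∷ refl ∷ refl ∷ refl ∷ refl ∷ [])
    , sumContents-only (just β) {single isβγ 0 0} (refl ∷ refl ∷ refl ∷ refl ∷ [])
  noRows zero (suc zero) =
      sumContents-only (just α) {single isαδ 0 1} (refl ∷ refl ∷ refl ∷ refl ∷ [])
    , sumContents-only (just γ) {single isβγ 0 1} (refl ∷ refl ∷ refl ∷ refl ∷ [])
  noRows zero (suc (suc l)) =
      none isαδ 0 (2 ℕ.+ l) (refl ∷ refl ∷ refl ∷ refl ∷ refl ∷ [])
    , none isβγ 0 (2 ℕ.+ l) (refl ∷ refl ∷ refl ∷ refl ∷ refl ∷ [])
  noRows (suc zero) zero =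
      sumContents-only (just δ) {single isαδ 1 0} (refl ∷ refl ∷ refl ∷ refl ∷ [])
    , none isβγ 1 0 (refl ∷ refl ∷ refl ∷ refl ∷ refl ∷ [])
  noRows (suc zero) (suc zero) =
      none isαδ 1 1 (refl ∷ refl ∷ refl ∷ refl ∷ refl ∷ [])
    , none isβγ 1 1 (refl ∷ refl ∷ refl ∷ refl ∷ refl ∷ [])
  noRows (suc zero) (suc (suc l)) =
      none isαδ 1 (2 ℕ.+ l) (refl ∷ refl ∷ refl ∷ refl ∷ refl ∷ [])
    , none isβγ 1 (2 ℕ.+ l) (refl ∷ refl ∷ refl ∷ refl ∷ refl ∷ [])
  noRows (suc (suc j)) zero =
      none isαδ (2 ℕ.+ j) 0 (refl ∷ refl ∷ refl ∷ refl ∷ refl ∷ [])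
    , none isβγ (2 ℕ.+ j) 0 (refl ∷ refl ∷ refl ∷ refl ∷ refl ∷ [])
  noRows (suc (suc j)) (suc zero) =
      none isαδ (2 ℕ.+ j) 1 (refl ∷ refl ∷ refl ∷ refl ∷ refl ∷ [])
    , none isβγ (2 ℕ.+ j) 1 (refl ∷ refl ∷ refl ∷ refl ∷ refl ∷ [])
  noRows (suc (suc j)) (suc (suc l)) =
      none isαδ (2 ℕ.+ j) (2 ℕ.+ l) (refl ∷ refl ∷ refl ∷ refl ∷ refl ∷ [])
    , none isβγ (2 ℕ.+ j) (2 ℕ.+ l) (refl ∷ refl ∷ refl ∷ refl ∷ refl ∷ [])

  module AddRow (old : List RowKind) where
    open Lowest old
    open import Relation.Binary.Reasoning.Setoid setoid

    private
      m = length old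

    expand : ∀ K bottom j l →
             rowSum bottom (old ∷ʳ K) j l ≈ sumColumns m (λ zs → sumContents (twoLowest zs K bottom j l))
    expand K bottom j l = begin
      sumColumns (suc (length (old ∷ʳ K))) F
        ≈⟨ reflexive (≡.cong (λ n → sumColumns (suc n) F) (length-++-comm old (K ∷ []))) ⟩
      sumColumns (suc (suc m)) F
        ≈⟨ sumColumns-bottom (suc m) F ⟩
      sumColumns (suc m) (λ ys → sumContents (λ x → F (ys ∷ʳ x)))
        ≈⟨ sumColumns-bottom m _ ⟩
      sumColumns m (λ zs → sumContents (λ y → sumContents (λ x → F ((zs ∷ʳ y) ∷ʳ x))))
        ≈⟨ sumOver-cong (allColumns m) (λ zs → sumOver-cong contents (λ y → sumOver-cong contents (λ x →
             reflexive (≡.cong₂ (λ ks col → colValue bottom ks 0 0 j l col)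
                                   (++-assoc old (K ∷ []) (newRow ∷ [])) (++-assoc zs (y ∷ []) (x ∷ [])))))) ⟩
      sumColumns m (λ zs → sumContents (twoLowest zs K bottom j l)) ∎
      where
        F = colValue bottom ((old ∷ʳ K) ++ newRow ∷ []) 0 0 j l

    collapse : ∀ bottom j l → sumColumns m (λ zs → oneLowest zs bottom j l) ≈ rowSum bottom old j l
    collapse bottom j l = sym (sumColumns-bottom m _)

    collapse-any : ∀ j l → sumColumns m (λ zs → oneLowest zs isαδ j l + oneLowest zs isβγ j l) ≈
                           rowSum isαδ old j l + rowSum isβγ old j l
    collapse-any j l = trans (sumOver-+ _ _ (allColumns m)) (+-cong (collapse isαδ j l) (collapse isβγ j l))

    peeled : ∀ K bottom j l {rhs : List (Maybe Lab) → Carrier} →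
             (∀ zs → length zs ≡ length old → sumContents (twoLowest zs K bottom j l) ≈ rhs zs) →
             rowSum bottom (old ∷ʳ K) j l ≈ sumColumns m rhs
    peeled K bottom j l e = trans (expand K bottom j l) (sumColumns-cong m e)

    add-β : ∀ bottom j l → rowSum bottom (old ∷ʳ βRow) j l ≈ rowSum bottom old j l
    add-β bottom j l =
      trans (peeled βRow bottom j l (λ zs len → Peel.peel-β old zs len bottom j l)) (collapse bottom j l)

    add-δ : ∀ bottom j l → rowSum bottom (old ∷ʳ δRow) j l ≈ prev (λ j' → q * rowSum bottom old j' l) j
    add-δ bottom j l = begin
      rowSum bottom (old ∷ʳ δRow) j l
        ≈⟨ peeled δRow bottom j l (λ zs len → Peel.peel-δ old zs len bottom j l) ⟩
      sumColumns m (λ zs → prev (λ j' → q * oneLowest zs bottom j' l) j)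
        ≈⟨ sumOver-prev (λ zs j' → q * oneLowest zs bottom j' l) (allColumns m) j ⟩
      prev (λ j' → sumColumns m (λ zs → q * oneLowest zs bottom j' l)) j
        ≈⟨ prev-cong (λ j' → trans (sumOver-*ˡ q _ (allColumns m)) (*-congˡ (collapse bottom j' l))) j ⟩
      prev (λ j' → q * rowSum bottom old j' l) j ∎

    add-αγ-D : ∀ j l → rowSum isαδ (old ∷ʳ αγRow) j l ≈
               d * prev (λ j' → rowSum isαδ old j' l + rowSum isβγ old j' l) j
               + prev (λ l' → rowSum isαδ old j l') l
    add-αγ-D j l = begin
      rowSum isαδ (old ∷ʳ αγRow) j l
        ≈⟨ peeled αγRow isαδ j l (λ zs len → Peel.peel-αγ-D old zs len j l) ⟩
      sumColumns m (λ zs → d * prev (λ j' → oneLowest zs isαδ j' l + oneLowest zs isβγ j' l) j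
                           + prev (λ l' → oneLowest zs isαδ j l') l)
        ≈⟨ sumOver-+ _ _ (allColumns m) ⟩
      sumColumns m (λ zs → d * prev (λ j' → oneLowest zs isαδ j' l + oneLowest zs isβγ j' l) j)
        + sumColumns m (λ zs → prev (λ l' → oneLowest zs isαδ j l') l)
        ≈⟨ +-cong (trans (sumOver-*ˡ d _ (allColumns m))
                         (*-congˡ (trans (sumOver-prev (λ zs j' → oneLowest zs isαδ j' l + oneLowest zs isβγ j' l)
                                                       (allColumns m) j)
                                         (prev-cong (λ j' → collapse-any j' l) j))))
                  (trans (sumOver-prev (λ zs l' → oneLowest zs isαδ j l') (allColumns m) l)
                         (prev-cong (λ l' → collapse isαδ j l') l)) ⟩
      d * prev (λ j' → rowSum isαδ old j' l + rowSum isβγ old j' l) j + prev (λ l' → rowSum isαδ old j l') l ∎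

    add-αγ-E : ∀ j l → rowSum isβγ (old ∷ʳ αγRow) j l ≈
               b * (rowSum isαδ old j l + rowSum isβγ old j l) + q * prev (λ l' → rowSum isβγ old j l') l
    add-αγ-E j l = begin
      rowSum isβγ (old ∷ʳ αγRow) j l
        ≈⟨ peeled αγRow isβγ j l (λ zs len → Peel.peel-αγ-E old zs len j l) ⟩
      sumColumns m (λ zs → b * (oneLowest zs isαδ j l + oneLowest zs isβγ j l)
                           + q * prev (λ l' → oneLowest zs isβγ j l') l)
        ≈⟨ sumOver-+ _ _ (allColumns m) ⟩
      sumColumns m (λ zs → b * (oneLowest zs isαδ j l + oneLowest zs isβγ j l))
        + sumColumns m (λ zs → q * prev (λ l' → oneLowest zs isβγ j l') l)
        ≈⟨ +-cong (trans (sumOver-*ˡ b _ (allColumns m)) (*-congˡ (collapse-any j l)))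
                  (trans (sumOver-*ˡ q _ (allColumns m))
                         (*-congˡ (trans (sumOver-prev (λ zs l' → oneLowest zs isβγ j l') (allColumns m) l)
                                         (prev-cong (λ l' → collapse isβγ j l') l)))) ⟩
      b * (rowSum isαδ old j l + rowSum isβγ old j l) + q * prev (λ l' → rowSum isβγ old j l') l ∎

  #δ-∷ʳ : ∀ old K → #δ (old ∷ʳ K) ≡ oneIf (isδ (kindIndex K)) ℕ.+ #δ old
  #δ-∷ʳ old K = count-∷ʳ (λ K → isδ (kindIndex K)) old K

  #αγ-∷ʳ : ∀ old K → #αγ (old ∷ʳ K) ≡ oneIf (isαγ (kindIndex K)) ℕ.+ #αγ old
  #αγ-∷ʳ old K = count-∷ʳ (λ K → isαγ (kindIndex K)) old K

  addRow : ∀ old {K} → Old K → Agrees old → Agrees (old ∷ʳ K)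
  addRow old β-old ih j l rewrite #δ-∷ʳ old βRow | #αγ-∷ʳ old βRow =
    trans (add-β isαδ j l) (proj₁ (ih j l)) , trans (add-β isβγ j l) (proj₂ (ih j l))
    where open AddRow old
  addRow old δ-old ih j l rewrite #δ-∷ʳ old δRow | #αγ-∷ʳ old δRow =
    trans (add-δ isαδ j l) (trans (prev-cong (λ j' → *-congˡ (proj₁ (ih j' l))) j) (proj₁ (D-δRow i j k l))) ,
    trans (add-δ isβγ j l) (trans (prev-cong (λ j' → *-congˡ (proj₂ (ih j' l))) j) (proj₂ (D-δRow i j k l)))
    where
      open AddRow old
      i = #δ old
      k = #αγ old
  addRow old αγ-old ih j l rewrite #δ-∷ʳ old αγRow | #αγ-∷ʳ old αγRow = D-part , E-part
    where
      open AddRow old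
      open import Relation.Binary.Reasoning.Setoid setoid
      i = #δ old
      k = #αγ old

      D-part : rowSum isαδ (old ∷ʳ αγRow) j l ≈ D i j (suc k) l
      D-part = begin
        rowSum isαδ (old ∷ʳ αγRow) j l
          ≈⟨ add-αγ-D j l ⟩
        d * prev (λ j' → rowSum isαδ old j' l + rowSum isβγ old j' l) j + prev (λ l' → rowSum isαδ old j l') l
          ≈⟨ +-cong (*-congˡ (prev-cong (λ j' → +-cong (proj₁ (ih j' l)) (proj₂ (ih j' l))) j))
                    (prev-cong (λ l' → proj₁ (ih j l')) l) ⟩
        DStep i j k l
          ≈⟨ sym (D-rec i j k l) ⟩
        D i j (suc k) l ∎

      E-part : rowSum isβγ (old ∷ʳ αγRow) j l ≈ E i j (suc k) l
      E-part = begin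
        rowSum isβγ (old ∷ʳ αγRow) j l
          ≈⟨ add-αγ-E j l ⟩
        b * (rowSum isαδ old j l + rowSum isβγ old j l) + q * prev (λ l' → rowSum isβγ old j l') l
          ≈⟨ +-cong (*-congˡ (+-cong (proj₁ (ih j l)) (proj₂ (ih j l))))
                    (*-congˡ (prev-cong (λ l' → proj₂ (ih j l')) l)) ⟩
        EStep i j k l
          ≈⟨ sym (E-rec i j k l) ⟩
        E i j (suc k) l ∎

  columnSums : ∀ old → All Old old → Agrees old
  columnSums old = byRows (reverseView old)
    where
      byRows : ∀ {old} → Reverse old → All Old old → Agrees old
      byRows [] _ = noRows
      byRows (old ∶ rows ∶ʳ K) old-K with ∷ʳ⁻ old-K
      ... | olds , oK = addRow old oK (byRows rows olds)

module Booleans where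
  ∧-true : ∀ {x y} → x ∧ y ≡ true → (x ≡ true) × (y ≡ true)
  ∧-true {true} {true} _ = ≡.refl , ≡.refl

  true-∧ : ∀ {x y} → x ≡ true → y ≡ true → x ∧ y ≡ true
  true-∧ ≡.refl ≡.refl = ≡.refl

  implies⁻ : ∀ {x y} → not x ∨ y ≡ true → x ≡ true → y ≡ true
  implies⁻ {true} h ≡.refl = h

  implies⁺ : ∀ x {y} → (x ≡ true → y ≡ true) → not x ∨ y ≡ true
  implies⁺ true h = h ≡.refl
  implies⁺ false h = ≡.refl

  not-true : ∀ {x} → not x ≡ true → x ≡ false
  not-true {false} _ = ≡.refl

  not-false : ∀ {x} → x ≡ false → not x ≡ true
  not-false ≡.refl = ≡.refl

  true≢false : true ≡ false → ⊥
  true≢false ()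

  bool-ext : ∀ {x y} → (x ≡ true → y ≡ true) → (y ≡ true → x ≡ true) → x ≡ y
  bool-ext {true} f _ = ≡.sym (f ≡.refl)
  bool-ext {false} {true} _ g = g ≡.refl
  bool-ext {false} {false} _ _ = ≡.refl

  isEmpty-nothing : ∀ {x : Maybe Lab} → isEmpty x ≡ true → x ≡ nothing
  isEmpty-nothing {nothing} _ = ≡.refl

-- Lists of values at the positions 0 … m-1.  Each statement is proved for
-- `applyUpTo g m`, which unfolds at position 0; note `upTo m = applyUpTo id m`.
module Positions where
  open Booleans
  open import Data.Nat using (_<_; z<s; s<s)
  open import Data.List using (upTo)
  open import Data.List.Properties using (map-upTo)
  open import Data.Product using (Σ)

  all⁻ : ∀ {A : Set} (p : A → Bool) g m → all p (applyUpTo g m) ≡ true → ∀ r → r < m → p (g r) ≡ true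
  all⁻ p g (suc m) h zero _ = proj₁ (∧-true h)
  all⁻ p g (suc m) h (suc r) (s<s r<m) = all⁻ p (λ r → g (suc r)) m (proj₂ (∧-true h)) r r<m

  all⁺ : ∀ {A : Set} (p : A → Bool) g m → (∀ r → r < m → p (g r) ≡ true) → all p (applyUpTo g m) ≡ true
  all⁺ p g zero h = ≡.refl
  all⁺ p g (suc m) h = true-∧ (h 0 z<s) (all⁺ p (λ r → g (suc r)) m (λ r r<m → h (suc r) (s<s r<m)))

  count-cong : ∀ {A B : Set} (p : A → Bool) (p' : B → Bool) g g' m →
               (∀ r → r < m → p (g r) ≡ p' (g' r)) → count p (applyUpTo g m) ≡ count p' (applyUpTo g' m)
  count-cong p p' g g' zero e = ≡.refl
  count-cong p p' g g' (suc m) e rewrite e 0 z<s =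
    ≡.cong (λ c → if p' (g' 0) then suc c else c)
           (count-cong p p' (λ r → g (suc r)) (λ r → g' (suc r)) m (λ r r<m → e (suc r) (s<s r<m)))

  map-upTo-suc : ∀ {a} {A : Set a} (h : ℕ → A) k → map h (upTo (suc k)) ≡ h 0 ∷ map (λ c → h (suc c)) (upTo k)
  map-upTo-suc h k = ≡.trans (map-upTo h (suc k)) (≡.cong (h 0 ∷_) (≡.sym (map-upTo (λ c → h (suc c)) k)))

  firstJust-∷ : ∀ {A : Set} (y : Maybe A) ys → firstJust (y ∷ ys) ≡ y <∣> firstJust ys
  firstJust-∷ (just z) ys = ≡.refl
  firstJust-∷ nothing ys = ≡.refl

  firstJust-none : ∀ {A : Set} (h : ℕ → Maybe A) m → firstJust (map h (upTo m)) ≡ nothing →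
                   ∀ c → c < m → h c ≡ nothing
  firstJust-none h m e = go h m (≡.trans (≡.cong firstJust (≡.sym (map-upTo h m))) e)
    where
      go : ∀ {A : Set} (h : ℕ → Maybe A) m → firstJust (applyUpTo h m) ≡ nothing →
           ∀ c → c < m → h c ≡ nothing
      go h (suc m) e c c<m with h 0 in h₀
      go h (suc m) e zero _ | nothing = h₀
      go h (suc m) e (suc c) (s<s c<m) | nothing = go (λ r → h (suc r)) m e c c<m

  firstJust-some : ∀ {A : Set} (h : ℕ → Maybe A) m z → firstJust (map h (upTo m)) ≡ just z →
                   Σ ℕ (λ c → c < m × h c ≡ just z)
  firstJust-some h m z e = go h m (≡.trans (≡.cong firstJust (≡.sym (map-upTo h m))) e)
    where
      go : ∀ {A : Set} {z : A} (h : ℕ → Maybe A) m → firstJust (applyUpTo h m) ≡ just z →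
           Σ ℕ (λ c → c < m × h c ≡ just z)
      go h (suc m) e with h 0 in h₀
      ... | just _ = 0 , z<s , ≡.trans h₀ e
      ... | nothing with go (λ r → h (suc r)) m e
      ...   | c , c<m , hc = suc c , s<s c<m , hc

  firstJust-first : ∀ {A : Set} (h : ℕ → Maybe A) m c₀ z → (∀ c → c < c₀ → h c ≡ nothing) →
                    c₀ < m → h c₀ ≡ just z → firstJust (map h (upTo m)) ≡ just z
  firstJust-first h m c₀ z before c₀<m hz =
    ≡.trans (≡.cong firstJust (map-upTo h m)) (go h m c₀ before c₀<m hz)
    where
      go : ∀ {A : Set} {z : A} (h : ℕ → Maybe A) m c₀ → (∀ c → c < c₀ → h c ≡ nothing) → c₀ < m →
           h c₀ ≡ just z → firstJust (applyUpTo h m) ≡ just z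
      go h (suc m) zero before _ hz rewrite hz = ≡.refl
      go h (suc m) (suc c₀) before (s<s c₀<m) hz rewrite before 0 z<s =
        go (λ r → h (suc r)) m c₀ (λ c c<c₀ → before (suc c) (s<s c<c₀)) c₀<m hz

module ColumnPositions where
  open Booleans
  open import Data.Nat using (_<_; z<s; s<s)
  open import Data.List using (upTo; drop)
  open import Data.List.Properties using (map-∘; map-upTo)

  at-bottom : ∀ col n → length col ≡ suc n → at col n ≡ bottomOf col
  at-bottom (x ∷ []) zero _ = ≡.refl
  at-bottom (x ∷ y ∷ ys) (suc n) e = at-bottom (y ∷ ys) n (suc-injective e)

  at-all : ∀ (col : List (Maybe Lab)) → applyUpTo (at col) (length col) ≡ col
  at-all [] = ≡.refl
  at-all (y ∷ ys) = ≡.cong (y ∷_) (at-all ys)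

  at-range : ∀ col a → map (at col) (range a (length col)) ≡ drop a col
  at-range col zero =
    ≡.trans (≡.sym (map-∘ (upTo (length col)))) (≡.trans (map-upTo (at col) (length col)) (at-all col))
  at-range [] (suc a) = ≡.refl
  at-range (y ∷ ys) (suc a) =
    ≡.trans (≡.sym (map-∘ (upTo (length ys ∸ a)))) (≡.trans (map-∘ (upTo (length ys ∸ a))) (at-range ys a))

  oneIf-+ : ∀ t c → oneIf t ℕ.+ c ≡ (if t then suc c else c)
  oneIf-+ true c = ≡.refl
  oneIf-+ false c = ≡.refl

  countIndexed-at : ∀ P (f : ℕ → RowKind) col →
    countIndexed P (applyUpTo f (length col)) col ≡
    count P (applyUpTo (λ r → at col r <∣> kindIndex (f r)) (length col))
  countIndexed-at P f [] = ≡.refl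
  countIndexed-at P f (y ∷ ys) =
    ≡.trans (≡.cong (oneIf (P (y <∣> kindIndex (f 0))) ℕ.+_) (countIndexed-at P (λ r → f (suc r)) ys))
            (oneIf-+ (P (y <∣> kindIndex (f 0))) _)

  Valid : (ℕ → RowKind) → Bool → List (Maybe Lab) → Set
  Valid f p col =
    (∀ r → r < length col → admits (f r) (at col r) ≡ true) ×
    (∀ r → r < length col → isαγ (at col r) ≡ true →
           (p ≡ true) × (∀ r' → r' < r → isEmpty (at col r') ≡ true))

  valid⁻ : ∀ f p col → valid (applyUpTo f (length col)) p col ≡ true → Valid f p col
  valid⁻ f p [] _ = (λ _ ()) , (λ _ ())
  valid⁻ f p (y ∷ ys) h = admitted , emptyAbove
    where
      h₁ = ∧-true h
      h₂ = ∧-true (proj₂ h₁)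
      rest = valid⁻ (λ r → f (suc r)) (isEmpty y ∧ p) ys (proj₂ h₂)

      admitted : ∀ r → r < suc (length ys) → admits (f r) (at (y ∷ ys) r) ≡ true
      admitted zero _ = proj₁ h₁
      admitted (suc r) (s<s r<m) = proj₁ rest r r<m

      emptyAbove : ∀ r → r < suc (length ys) → isαγ (at (y ∷ ys) r) ≡ true →
                   (p ≡ true) × (∀ r' → r' < r → isEmpty (at (y ∷ ys) r') ≡ true)
      emptyAbove zero _ αγ = implies⁻ (proj₁ h₂) αγ , λ _ ()
      emptyAbove (suc r) (s<s r<m) αγ with proj₂ rest r r<m αγ
      ... | emptyAndP , below = proj₂ (∧-true emptyAndP) , above
        where
          above : ∀ r' → r' < suc r → isEmpty (at (y ∷ ys) r') ≡ true
          above zero _ = proj₁ (∧-true emptyAndP)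
          above (suc r') (s<s r'<r) = below r' r'<r

  valid⁺ : ∀ f p col → Valid f p col → valid (applyUpTo f (length col)) p col ≡ true
  valid⁺ f p [] _ = ≡.refl
  valid⁺ f p (y ∷ ys) (admitted , emptyAbove) =
    true-∧ (admitted 0 z<s)
      (true-∧ (implies⁺ (isαγ y) (λ αγ → proj₁ (emptyAbove 0 z<s αγ)))
        (valid⁺ (λ r → f (suc r)) (isEmpty y ∧ p) ys
          ((λ r r<m → admitted (suc r) (s<s r<m)) ,
           (λ r r<m αγ → let (p-true , above) = emptyAbove (suc r) (s<s r<m) αγ in
                         true-∧ (above 0 z<s) p-true , (λ r' r'<r → above (suc r') (s<s r'<r))))))

module Staircases where
  open Booleans
  open Positions
  open import Data.Nat using (_<_)
  open import Function using (id)
  open import Data.List using (upTo)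

  record Staircase (m : ℕ) (U : Tab) : Set where
    field
      diagonal : ∀ r → r < m → isEmpty (U r (m ∸ suc r)) ≡ false
      leftOfβδ : ∀ r c → r < m → c < m ∸ r → isβδ (U r c) ≡ true →
                 ∀ c' → c' < c → isEmpty (U r c') ≡ true
      aboveαγ : ∀ r c → r < m → c < m ∸ r → isαγ (U r c) ≡ true →
                ∀ r' → r' < r → isEmpty (U r' c) ≡ true

  private
    module Rules (m : ℕ) (U : Tab) where
      Diagonals RowRule ColumnRule : Bool
      Diagonals = all (λ r → not (isEmpty (U r (m ∸ suc r)))) (upTo m)
      RowRule = allBoxes m (λ r c → not (isβδ (U r c)) ∨ all (λ c' → isEmpty (U r c')) (upTo c))
      ColumnRule = allBoxes m (λ r c → not (isαγ (U r c)) ∨ all (λ r' → isEmpty (U r' c)) (upTo r))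

  staircase⁻ : ∀ m U → isStaircase m U ≡ true → Staircase m U
  staircase⁻ m U h = record
    { diagonal = λ r r<m → not-true (all⁻ _ id m diagonals r r<m)
    ; leftOfβδ = λ r c r<m c<m βδ →
        all⁻ _ id c (implies⁻ (all⁻ _ id (m ∸ r) (all⁻ _ id m rowRule r r<m) c c<m) βδ)
    ; aboveαγ = λ r c r<m c<m αγ →
        all⁻ _ id r (implies⁻ (all⁻ _ id (m ∸ r) (all⁻ _ id m columnRule r r<m) c c<m) αγ)
    }
    where
      open Rules m U
      diagonals : Diagonals ≡ true
      diagonals = proj₁ (∧-true h)
      rowRule : RowRule ≡ true
      rowRule = proj₁ (∧-true (proj₂ (∧-true {Diagonals} h)))
      columnRule : ColumnRule ≡ true
      columnRule = proj₂ (∧-true (proj₂ (∧-true {Diagonals} h)))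

  staircase⁺ : ∀ m U → Staircase m U → isStaircase m U ≡ true
  staircase⁺ m U st = true-∧ diagonals (true-∧ rowRule columnRule)
    where
      open Staircase st
      open Rules m U
      diagonals : Diagonals ≡ true
      diagonals = all⁺ _ id m (λ r r<m → not-false (diagonal r r<m))
      rowRule : RowRule ≡ true
      rowRule = all⁺ _ id m (λ r r<m → all⁺ _ id (m ∸ r) (λ c c<m →
                  implies⁺ (isβδ (U r c)) (λ βδ → all⁺ _ id c (leftOfβδ r c r<m c<m βδ))))
      columnRule : ColumnRule ≡ true
      columnRule = all⁺ _ id m (λ r r<m → all⁺ _ id (m ∸ r) (λ c c<m →
                     implies⁺ (isαγ (U r c)) (λ αγ → all⁺ _ id r (aboveαγ r c r<m c<m αγ))))

-- The kind of a row with the given index (no index: the new bottom row).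
kindOf : Maybe Lab → RowKind
kindOf nothing = newRow
kindOf (just α) = αγRow
kindOf (just γ) = αγRow
kindOf (just β) = βRow
kindOf (just δ) = δRow

-- The representative index of a kind is as good as the index itself for any
-- property that does not distinguish α from γ.
index-kind : ∀ (P : Maybe Lab → Bool) → P (just α) ≡ P (just γ) →
             ∀ y ρ → P (y <∣> kindIndex (kindOf ρ)) ≡ P (y <∣> ρ)
index-kind P αγ (just z) ρ = ≡.refl
index-kind P αγ nothing nothing = ≡.refl
index-kind P αγ nothing (just α) = ≡.refl
index-kind P αγ nothing (just β) = ≡.refl
index-kind P αγ nothing (just γ) = αγ
index-kind P αγ nothing (just δ) = ≡.refl

admits-βδ : ∀ ρ x → isβδ ρ ≡ true → admits (kindOf ρ) x ≡ true → isEmpty x ≡ true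
admits-βδ (just β) x _ h = h
admits-βδ (just δ) x _ h = h

module NewColumn (n : ℕ) (T : Tab) (col : List (Maybe Lab)) (len : length col ≡ suc n) where
  open Booleans
  open Positions
  open ColumnPositions
  open Staircases
  open import Data.Nat using (_<_; _≤_; z<s; s<s)
  open import Data.Nat.Properties using (+-∸-assoc; ≤-pred; m∸n≢0⇒n<m; pred[m∸n]≡m∸[1+n]; n<1+n)
  open import Data.List using (upTo)
  open import Data.Empty using (⊥-elim)

  T' : Tab
  T' = addColumn col T

  kind : ℕ → RowKind
  kind r = kindOf (rowIndex n T r)

  suc∸ : ∀ {r} → r ≤ n → suc n ∸ r ≡ suc (n ∸ r)
  suc∸ r≤n = +-∸-assoc 1 r≤n

  rowIndex-new : ∀ r → r ≤ n → rowIndex (suc n) T' r ≡ at col r <∣> rowIndex n T r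
  rowIndex-new r r≤n =
    ≡.trans (≡.cong (λ m → firstJust (map (T' r) (upTo m))) (suc∸ r≤n))
            (≡.trans (≡.cong firstJust (map-upTo-suc (T' r) (n ∸ r))) (firstJust-∷ (at col r) _))

  counts-new : ∀ P → P (just α) ≡ P (just γ) →
    count (λ r → P (rowIndex (suc n) T' r)) (upTo (suc n)) ≡ countIndexed P (applyUpTo kind (suc n)) col
  counts-new P αγ =
    ≡.trans (count-cong _ P (λ r → r) newIndex (suc n) (λ r r<sn →
               ≡.trans (≡.cong P (rowIndex-new r (≤-pred r<sn)))
                       (≡.sym (index-kind P αγ (at col r) (rowIndex n T r)))))
            (≡.sym (≡.subst (λ m → countIndexed P (applyUpTo kind m) col ≡ count P (applyUpTo newIndex m))
                            len (countIndexed-at P kind col)))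
    where
      newIndex : ℕ → Maybe Lab
      newIndex r = at col r <∣> kindIndex (kind r)

  private
    to-len : ∀ {r} → r < suc n → r < length col
    to-len {r} = ≡.subst (r <_) (≡.sym len)

    from-len : ∀ {r} → r < length col → r < suc n
    from-len {r} = ≡.subst (r <_) len

    shift< : ∀ {r c} → r < suc n → c < n ∸ r → suc c < suc n ∸ r
    shift< {c = c} r<sn c< = ≡.subst (suc c <_) (≡.sym (suc∸ (≤-pred r<sn))) (s<s c<)

    unshift< : ∀ {r c} → r < suc n → suc c < suc n ∸ r → c < n ∸ r
    unshift< {c = c} r<sn lt = ≤-pred (≡.subst (suc c <_) (suc∸ (≤-pred r<sn)) lt)

    row< : ∀ {r c} → c < n ∸ r → r < n
    row< {c = c} c< = m∸n≢0⇒n<m (λ e → below-zero (≡.subst (c <_) e c<))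
      where
        below-zero : c < 0 → ⊥
        below-zero ()

  -- In a staircase tableau a row containing β or δ is indexed by β or δ,
  -- since all boxes to its left are empty.
  indexed-βδ : Staircase n T → ∀ r c → c < n ∸ r → isβδ (T r c) ≡ true → isβδ (rowIndex n T r) ≡ true
  indexed-βδ st r c c< βδ with T r c in hz
  ... | just z = ≡.trans (≡.cong isβδ (firstJust-first (T r) (n ∸ r) c z before c< hz)) βδ
    where
      before : ∀ c' → c' < c → T r c' ≡ nothing
      before c' c'<c =
        isEmpty-nothing (Staircase.leftOfβδ st r c (row< c<) c< (≡.trans (≡.cong isβδ hz) βδ) c' c'<c)

  extend⁻ : Staircase (suc n) T' → Valid kind true col
  extend⁻ st = admitted , (λ r r<len αγ → ≡.refl , aboveαγ r 0 (from-len r<len) (first (from-len r<len)) αγ)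
    where
      open Staircase st

      first : ∀ {r} → r < suc n → 0 < suc n ∸ r
      first r<sn = ≡.subst (0 <_) (≡.sym (suc∸ (≤-pred r<sn))) z<s

      admitted : ∀ r → r < length col → admits (kind r) (at col r) ≡ true
      admitted r r<len = byIndex (rowIndex n T r) ≡.refl
        where
          r<sn = from-len r<len

          diagonal-at : ∀ s → n ∸ r ≡ s → isEmpty (T' r s) ≡ false
          diagonal-at s e = ≡.subst (λ s → isEmpty (T' r s) ≡ false) e (diagonal r r<sn)

          byIndex : ∀ ρ → rowIndex n T r ≡ ρ → admits (kindOf ρ) (at col r) ≡ true
          byIndex nothing none = not-false (labelled (n ∸ r) ≡.refl)
            where
              -- an unindexed row is the bottom row, whose diagonal box is the new box
              labelled : ∀ s → n ∸ r ≡ s → isEmpty (at col r) ≡ false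
              labelled zero e = diagonal-at zero e
              labelled (suc c) e =
                ⊥-elim (true≢false (≡.trans (≡.cong isEmpty (≡.sym emptyBox)) (diagonal-at (suc c) e)))
                where emptyBox = firstJust-none (T r) (n ∸ r) none c (≡.subst (c <_) (≡.sym e) (n<1+n c))
          byIndex (just α) _ = ≡.refl
          byIndex (just γ) _ = ≡.refl
          byIndex (just β) e with firstJust-some (T r) (n ∸ r) β e
          ... | c , c< , hc = leftOfβδ r (suc c) r<sn (shift< r<sn c<) (≡.cong isβδ hc) 0 z<s
          byIndex (just δ) e with firstJust-some (T r) (n ∸ r) δ e
          ... | c , c< , hc = leftOfβδ r (suc c) r<sn (shift< r<sn c<) (≡.cong isβδ hc) 0 z<s

  extend⁺ : Staircase n T → Valid kind true col → Staircase (suc n) T'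
  extend⁺ st (admitted , columnOK) =
    record { diagonal = diagonal′ ; leftOfβδ = leftOfβδ′ ; aboveαγ = aboveαγ′ }
    where
      open Staircase st

      diagonal′ : ∀ r → r < suc n → isEmpty (T' r (n ∸ r)) ≡ false
      diagonal′ r r<sn = byLength (n ∸ r) ≡.refl
        where
          byLength : ∀ s → n ∸ r ≡ s → isEmpty (T' r s) ≡ false
          byLength zero e =
            not-true (≡.subst (λ s → admits (kindOf (firstJust (map (T r) (upTo s)))) (at col r) ≡ true) e
                              (admitted r (to-len r<sn)))
          byLength (suc c) e = ≡.subst (λ c → isEmpty (T r c) ≡ false) c≡ (diagonal r (row< c<))
            where
              c< : c < n ∸ r
              c< = ≡.subst (c <_) (≡.sym e) (n<1+n c)
              c≡ : n ∸ suc r ≡ c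
              c≡ = ≡.trans (≡.sym (pred[m∸n]≡m∸[1+n] n r)) (≡.cong ℕ.pred e)

      leftOfβδ′ : ∀ r c → r < suc n → c < suc n ∸ r → isβδ (T' r c) ≡ true →
                  ∀ c' → c' < c → isEmpty (T' r c') ≡ true
      leftOfβδ′ r (suc c) r<sn lt βδ zero _ =
        admits-βδ (rowIndex n T r) (at col r) (indexed-βδ st r c (unshift< r<sn lt) βδ) (admitted r (to-len r<sn))
      leftOfβδ′ r (suc c) r<sn lt βδ (suc c') (s<s c'<c) =
        leftOfβδ r c (row< (unshift< r<sn lt)) (unshift< r<sn lt) βδ c' c'<c

      aboveαγ′ : ∀ r c → r < suc n → c < suc n ∸ r → isαγ (T' r c) ≡ true →
                 ∀ r' → r' < r → isEmpty (T' r' c) ≡ true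
      aboveαγ′ r zero r<sn _ αγ = proj₂ (columnOK r (to-len r<sn) αγ)
      aboveαγ′ r (suc c) r<sn lt αγ = aboveαγ r c (row< (unshift< r<sn lt)) (unshift< r<sn lt) αγ

  staircase-new : isStaircase n T ≡ true → isStaircase (suc n) T' ≡ valid (applyUpTo kind (suc n)) true col
  staircase-new hT = bool-ext
    (λ h → ≡.subst validAt len (valid⁺ kind true col (extend⁻ (staircase⁻ (suc n) T' h))))
    (λ h → staircase⁺ (suc n) T'
             (extend⁺ (staircase⁻ n T hT) (valid⁻ kind true col (≡.subst validAt (≡.sym len) h))))
    where
      validAt : ℕ → Set
      validAt m = valid (applyUpTo kind m) true col ≡ true

module BoxWeights {c ℓ : Level} (R : CommutativeSemiring c ℓ)
                  (a b g d q : CommutativeSemiring.Carrier R) where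
  open CommutativeSemiring R hiding (zero)
  open Weights R a b g d q using (boxWt)
  open SemiringSums R
  open ColumnValues R a b g d q
  open import Data.List using (drop)

  boxWt-cellWt : ∀ m U r c → boxWt m U r c ≡ cellWt (kindOf (closestRight m U r c)) (U r c) (closestBelow m U r c)
  boxWt-cellWt m U r c with U r c
  ... | just x = ≡.refl
  ... | nothing with closestRight m U r c
  ...   | nothing = ≡.refl
  ...   | just β = ≡.refl
  ...   | just δ = ≡.refl
  ...   | just α with closestBelow m U r c
  ...     | nothing = ≡.refl
  ...     | just α = ≡.refl
  ...     | just β = ≡.refl
  ...     | just γ = ≡.refl
  ...     | just δ = ≡.refl
  boxWt-cellWt m U r c | nothing | just γ with closestBelow m U r c
  ...     | nothing = ≡.refl
  ...     | just α = ≡.refl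
  ...     | just β = ≡.refl
  ...     | just γ = ≡.refl
  ...     | just δ = ≡.refl

  cellWtAt : (ℕ → RowKind) → List (Maybe Lab) → ℕ → Carrier
  cellWtAt f col r = cellWt (f r) (at col r) (firstJust (drop (suc r) col))

  weight-at : ∀ (f : ℕ → RowKind) col →
              weight (applyUpTo f (length col)) col ≈ product (applyUpTo (cellWtAt f col) (length col))
  weight-at f [] = refl
  weight-at f (y ∷ ys) = *-congˡ (weight-at (λ r → f (suc r)) ys)

module TableauSums {c ℓ : Level} (R : CommutativeSemiring c ℓ)
                   (a b g d q : CommutativeSemiring.Carrier R) (n : ℕ) (T : Tab) where
  open CommutativeSemiring R hiding (zero)
  open Weights R a b g d q using (boxWt; wt; D; E; columnSum)
  open SemiringSums R
  open ColumnValues R a b g d q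
  open BoxWeights R a b g d q
  open Positions using (map-upTo-suc)
  open import Relation.Binary.Reasoning.Setoid setoid
  open import Data.Nat using (_<_; _≤_)
  open import Data.Nat.Properties using (≤-pred; n∸n≡0; n<1+n; ∸-monoʳ-<)
  open import Data.List using (upTo; drop)
  open import Data.List.Properties
    using (map-upTo; map-∘; map-cong; upTo-∷ʳ; map-++; applyUpTo-∷ʳ; length-applyUpTo)
  open import Data.List.Relation.Unary.All.Properties using (applyUpTo⁺₁)
  open import Data.Empty using (⊥-elim)

  rowKind : ℕ → RowKind
  rowKind r = kindOf (rowIndex n T r)

  oldRows : List RowKind
  oldRows = applyUpTo rowKind n

  allRows : applyUpTo rowKind (suc n) ≡ oldRows ++ newRow ∷ []
  allRows = ≡.trans (≡.sym (applyUpTo-∷ʳ rowKind n)) (≡.cong (λ K → oldRows ++ K ∷ []) bottomRow)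
    where
      bottomRow : rowKind n ≡ newRow
      bottomRow = ≡.cong (λ m → kindOf (firstJust (map (T n) (upTo m)))) (n∸n≡0 n)

  -- Every row of a staircase tableau is indexed, since its diagonal box is labelled.
  oldRows-old : isStaircase n T ≡ true → All Old oldRows
  oldRows-old hT = applyUpTo⁺₁ rowKind n (λ {r} r<n → indexed r r<n (rowIndex n T r) ≡.refl)
    where
      open Booleans
      open Staircases
      indexed : ∀ r → r < n → ∀ ρ → rowIndex n T r ≡ ρ → Old (kindOf ρ)
      indexed r r<n nothing none =
        ⊥-elim (true≢false (≡.trans (≡.cong isEmpty (≡.sym diagonalBox))
                                    (Staircase.diagonal (staircase⁻ n T hT) r r<n)))
        where diagonalBox = Positions.firstJust-none (T r) (n ∸ r) none (n ∸ suc r) (∸-monoʳ-< (n<1+n r) r<n)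
      indexed r r<n (just α) _ = αγ-old
      indexed r r<n (just γ) _ = αγ-old
      indexed r r<n (just β) _ = β-old
      indexed r r<n (just δ) _ = δ-old

  counts-old : ∀ P → P (just α) ≡ P (just γ) →
               count (λ K → P (kindIndex K)) oldRows ≡ count (λ r → P (rowIndex n T r)) (upTo n)
  counts-old P αγ = Positions.count-cong _ _ rowKind (λ r → r) n (λ r _ → index-kind P αγ nothing (rowIndex n T r))

  rowWt : ℕ → Carrier
  rowWt r = product (map (boxWt n T r) (colsOf n r))

  rows-wt : product (map rowWt (upTo (suc n))) ≈ wt n T
  rows-wt = begin
    product (map rowWt (upTo (suc n)))
      ≈⟨ reflexive (≡.cong (λ rs → product (map rowWt rs)) (≡.sym (upTo-∷ʳ n))) ⟩
    product (map rowWt (upTo n ++ n ∷ []))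
      ≈⟨ reflexive (≡.cong product (map-++ rowWt (upTo n) (n ∷ []))) ⟩
    product (map rowWt (upTo n) ++ rowWt n ∷ [])
      ≈⟨ product-++ (map rowWt (upTo n)) (rowWt n ∷ []) ⟩
    product (map rowWt (upTo n)) * (rowWt n * 1#)
      ≈⟨ *-congˡ (trans (*-identityʳ _) emptyRow) ⟩
    product (map rowWt (upTo n)) * 1#
      ≈⟨ *-identityʳ _ ⟩
    product (map rowWt (upTo n))
      ≈⟨ sym (product-concatMap (λ r → map (boxWt n T r) (colsOf n r)) (upTo n)) ⟩
    wt n T ∎
    where
      -- row n has no boxes
      emptyRow : rowWt n ≈ 1#
      emptyRow = reflexive (≡.cong (λ m → product (map (boxWt n T n) (upTo m))) (n∸n≡0 n))

  module _ (col : List (Maybe Lab)) (len : length col ≡ suc n) where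
    open NewColumn n T col len
    open ColumnPositions using (at-range; at-bottom)

    right-first : ∀ r → r ≤ n → closestRight (suc n) T' r 0 ≡ rowIndex n T r
    right-first r r≤n = ≡.trans (≡.cong (λ m → firstJust (map (T' r) (range 1 m))) (suc∸ r≤n))
                                (≡.cong firstJust (≡.sym (map-∘ (upTo (n ∸ r)))))

    below-first : ∀ r → closestBelow (suc n) T' r 0 ≡ firstJust (drop (suc r) col)
    below-first r =
      ≡.cong firstJust (≡.trans (≡.cong (λ m → map (at col) (range (suc r) m)) (≡.sym len))
                                (at-range col (suc r)))

    right-shifted : ∀ r c → r ≤ n → closestRight (suc n) T' r (suc c) ≡ closestRight n T r c
    right-shifted r c r≤n =
      ≡.trans (≡.cong (λ m → firstJust (map (T' r) (range (suc (suc c)) m))) (suc∸ r≤n))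
              (≡.cong firstJust (≡.trans (≡.sym (map-∘ boxes)) (map-∘ boxes)))
      where boxes = upTo ((n ∸ r) ∸ suc c)

    boxWt-first : ∀ r → r ≤ n → boxWt (suc n) T' r 0 ≡ cellWtAt kind col r
    boxWt-first r r≤n =
      ≡.trans (boxWt-cellWt (suc n) T' r 0)
              (≡.cong₂ (λ ρ f → cellWt (kindOf ρ) (at col r) f) (right-first r r≤n) (below-first r))

    boxWt-shifted : ∀ r → r ≤ n → ∀ c → boxWt (suc n) T' r (suc c) ≡ boxWt n T r c
    boxWt-shifted r r≤n c =
      ≡.trans (boxWt-cellWt (suc n) T' r (suc c))
        (≡.trans (≡.cong (λ ρ → cellWt (kindOf ρ) (T r c) (closestBelow n T r c)) (right-shifted r c r≤n))
                 (≡.sym (boxWt-cellWt n T r c)))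

    row-new : ∀ r → r ≤ n → product (map (boxWt (suc n) T' r) (colsOf (suc n) r)) ≈ boxWt (suc n) T' r 0 * rowWt r
    row-new r r≤n = reflexive
      (≡.trans (≡.cong (λ m → product (map (boxWt (suc n) T' r) (upTo m))) (suc∸ r≤n))
        (≡.trans (≡.cong product (map-upTo-suc (boxWt (suc n) T' r) (n ∸ r)))
                 (≡.cong (λ xs → boxWt (suc n) T' r 0 * product xs)
                         (map-cong (boxWt-shifted r r≤n) (upTo (n ∸ r))))))

    first-column : product (map (λ r → boxWt (suc n) T' r 0) (upTo (suc n))) ≈ weight (applyUpTo kind (suc n)) col
    first-column = begin
      product (map (λ r → boxWt (suc n) T' r 0) (upTo (suc n)))
        ≈⟨ reflexive (≡.cong product (map-upTo _ (suc n))) ⟩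
      product (applyUpTo (λ r → boxWt (suc n) T' r 0) (suc n))
        ≈⟨ product-cong _ _ (suc n) (λ r r<sn → reflexive (boxWt-first r (≤-pred r<sn))) ⟩
      product (applyUpTo (cellWtAt kind col) (suc n))
        ≈⟨ sym (≡.subst (λ m → weight (applyUpTo kind m) col ≈ product (applyUpTo (cellWtAt kind col) m))
                        len (weight-at kind col)) ⟩
      weight (applyUpTo kind (suc n)) col ∎

    weight-new : wt (suc n) T' ≈ wt n T * weight (applyUpTo kind (suc n)) col
    weight-new = begin
      wt (suc n) T'
        ≈⟨ product-concatMap (λ r → map (boxWt (suc n) T' r) (colsOf (suc n) r)) (upTo (suc n)) ⟩
      product (map (λ r → product (map (boxWt (suc n) T' r) (colsOf (suc n) r))) (upTo (suc n)))
        ≈⟨ reflexive (≡.cong product (map-upTo _ (suc n))) ⟩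
      product (applyUpTo (λ r → product (map (boxWt (suc n) T' r) (colsOf (suc n) r))) (suc n))
        ≈⟨ product-cong _ _ (suc n) (λ r r<sn → row-new r (≤-pred r<sn)) ⟩
      product (applyUpTo (λ r → boxWt (suc n) T' r 0 * rowWt r) (suc n))
        ≈⟨ reflexive (≡.cong product (≡.sym (map-upTo _ (suc n)))) ⟩
      product (map (λ r → boxWt (suc n) T' r 0 * rowWt r) (upTo (suc n)))
        ≈⟨ product-* (λ r → boxWt (suc n) T' r 0) rowWt (upTo (suc n)) ⟩
      product (map (λ r → boxWt (suc n) T' r 0) (upTo (suc n))) * product (map rowWt (upTo (suc n)))
        ≈⟨ *-cong first-column rows-wt ⟩
      weight (applyUpTo kind (suc n)) col * wt n T
        ≈⟨ *-comm _ _ ⟩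
      wt n T * weight (applyUpTo kind (suc n)) col ∎

    summand-new : ∀ bottom j l → isStaircase n T ≡ true →
      (if isStaircase (suc n) T' ∧ bottom (at col n) ∧ (#δrows (suc n) T' ≡ᵇ j) ∧ (#αγrows (suc n) T' ≡ᵇ l)
       then wt (suc n) T' else 0#) ≈ wt n T * colValue bottom (applyUpTo kind (suc n)) 0 0 j l col
    summand-new bottom j l hT =
      trans (if-cong (≡.cong₂ _∧_ (staircase-new hT)
                       (≡.cong₂ (λ x y → bottom x ∧ y) (at-bottom col n len)
                         (≡.cong₂ (λ x y → (x ≡ᵇ j) ∧ (y ≡ᵇ l))
                                  (counts-new isδ ≡.refl) (counts-new isαγ ≡.refl))))
                     weight-new)
            (if-*ˡ _ (wt n T) _)

  columnSum-rows : ∀ bottom j l → isStaircase n T ≡ true →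
                   columnSum bottom n T j l ≈ wt n T * rowSum bottom oldRows j l
  columnSum-rows bottom j l hT = begin
    columnSum bottom n T j l
      ≈⟨ sumColumns-cong (suc n) (λ col len → summand-new col len bottom j l hT) ⟩
    sumColumns (suc n) (λ col → wt n T * colValue bottom (applyUpTo rowKind (suc n)) 0 0 j l col)
      ≈⟨ sumOver-*ˡ (wt n T) _ (allColumns (suc n)) ⟩
    wt n T * sumColumns (suc n) (colValue bottom (applyUpTo rowKind (suc n)) 0 0 j l)
      ≈⟨ *-congˡ (reflexive (≡.cong₂ (λ m ks → sumColumns (suc m) (colValue bottom ks 0 0 j l))
                                      (≡.sym (length-applyUpTo rowKind n)) allRows)) ⟩
    wt n T * rowSum bottom oldRows j l ∎

lemma6p5 : {c ℓ : Level} (R : CommutativeSemiring c ℓ)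
    (a b g d q : CommutativeSemiring.Carrier R)
    (i j k l n : ℕ) (T : Tab) →
    isStaircase n T ≡ true → #δrows n T ≡ i → #αγrows n T ≡ k →
    CommutativeSemiring._≈_ R
      (CommutativeSemiring._*_ R (Weights.D R a b g d q i j k l) (Weights.wt R a b g d q n T))
      (Weights.columnSum R a b g d q isαδ n T j l)
    ×
    CommutativeSemiring._≈_ R
      (CommutativeSemiring._*_ R (Weights.E R a b g d q i j k l) (Weights.wt R a b g d q n T))
      (Weights.columnSum R a b g d q isβγ n T j l)
lemma6p5 R a b g d q .(#δrows n T) j .(#αγrows n T) l n T hT ≡.refl ≡.refl =
  scaled isαδ (proj₁ sums) , scaled isβγ (proj₂ sums)
  where
    open CommutativeSemiring R hiding (zero)
    open Weights R a b g d q using (D; E; wt; columnSum)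
    open ColumnValues R a b g d q using (rowSum; columnSums)
    open TableauSums R a b g d q n T using (oldRows; oldRows-old; counts-old; columnSum-rows)

    sums : (rowSum isαδ oldRows j l ≈ D (#δrows n T) j (#αγrows n T) l) ×
           (rowSum isβγ oldRows j l ≈ E (#δrows n T) j (#αγrows n T) l)
    sums = ≡.subst₂ (λ i k → (rowSum isαδ oldRows j l ≈ D i j k l) × (rowSum isβγ oldRows j l ≈ E i j k l))
                    (counts-old isδ ≡.refl) (counts-old isαγ ≡.refl) (columnSums oldRows (oldRows-old hT) j l)

    scaled : ∀ bottom {x} → rowSum bottom oldRows j l ≈ x → x * wt n T ≈ columnSum bottom n T j l
    scaled bottom e = trans (*-comm _ _) (trans (*-congˡ (sym e)) (sym (columnSum-rows bottom j l hT)))
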